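{- Let $n\ge1$. The map $\Psi$ defined below takes values in $\overline{\mathcal M}_{n+1}$ and is a bijection $\Psi:\mathrm{MAD}(c^\times)\to\overline{\mathcal M}_{n+1}$.
   Context: Place points labeled $1,\dots,n+1$ from left to right on a horizontal line. An arc is a curve moving monotonically rightward from a point $i$ to a point $j>i$, passing above or below each of $i+1,\dots,j-1$; arcs are identified if they have the same endpoints and pass above the same points. A noncrossing arc diagram is a set of arcs that can be drawn so that no two share a left endpoint, no two share a right endpoint, and no two cross in their interiors; $|\delta|$ is the number of arcs of $\delta$. An arc is $c^\times$-sortable if it passes above every odd interior point $k$ and below every even interior point $k$. $\mathrm{MAD}(c^\times)$ is the set of noncrossing arc diagrams all of whose arcs are $c^\times$-sortable and which are maximal under inclusion among such diagrams. A Motzkin path of length $m$ is a word $\mathtt M_1\cdots\mathtt M_m$ over $\{\mathtt U,\mathtt D,\mathtt H\}$ with equally many $\mathtt U$'s and $\mathtt D$'s and at least as many $\mathtt U$'s as $\mathtt D$'s in every prefix. A peak is a consecutive occurrence $\mathtt U\mathtt D$; its height is $\#\mathtt U-\#\mathtt D$ in the prefix ending with that $\mathtt U$. $\overline{\mathcal M}_{m}$ is the set of Motzkin paths of length $m$ with no peak of height $1$. For $\delta\in\mathrm{MAD}(c^\times)$, $\Psi(\delta)=\mathtt M_1\cdots\mathtt M_{n+1}$ where $\mathtt M_i=\mathtt U$ if $i\le n$ and $i+1$ is not the right endpoint of an arc of $\delta$; $\mathtt M_i=\mathtt D$ if $i\ge2$ and $i-1$ is not the left endpoint of an arc of $\delta$;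 and $\mathtt M_i=\mathtt H$ otherwise. (For $\delta\in\mathrm{MAD}(c^\times)$ the first two cases never occur simultaneously, so $\Psi$ is well defined.) -}

module Defs where

open import Data.Nat using (ℕ; zero; suc; _+_; _≤_; _<_; _≡ᵇ_)
open import Data.Bool using (Bool; true; false; if_then_else_)
open import Data.Fin using (Fin; toℕ)
open import Data.Vec using (Vec; lookup)
open import Data.List using (List; []; _∷_; _++_; map; upTo; length; filter)
open import Data.Bool.ListAction using (any)
open import Data.List.Membership.Propositional using (_∈_)
open import Data.Product using (Σ; _×_; _,_; ∃)
open import Relation.Binary.PropositionalEquality using (_≡_; _≢_)
open import Relation.Nullary using (¬_)

-- Points are the natural numbers 1,…,n+1.  An arc is given by its
-- left endpoint, the number `gap` of interior points (so its right endpoint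
-- is left + suc gap), and for each interior point left+1+k (k : Fin gap)
-- whether the arc passes above (true) or below (false) it.  Two arcs are
-- identified iff they have the same endpoints and pass above the same points,
-- which is exactly propositional equality of this record.

record Arc : Set where
  constructor arc
  field
    left  : ℕ
    gap   : ℕ
    sides : Vec Bool gap

open Arc public

right : Arc → ℕ
right a = left a + suc (gap a)

InRange : ℕ → Arc → Set
InRange n a = (1 ≤ left a) × (right a ≤ suc n)

odd : ℕ → Bool
odd zero = false
odd (suc m) = if odd m then false else true

Sortable : Arc → Set
Sortable a = (k : Fin (gap a)) → lookup (sides a) k ≡ odd (left a + suc (toℕ k))

data Pos : Set where
  Above Below At : Pos

data Side (a : Arc) : ℕ → Pos → Set where
  at-left  : Side a (left a) At
  at-right : Side a (right a) At
  interior : (k : Fin (gap a)) →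
             Side a (left a + suc (toℕ k))
                  (if lookup (sides a) k then Above else Below)

data Higher : Pos → Pos → Set where
  ab-be : Higher Above Below
  ab-at : Higher Above At
  at-be : Higher At Below

AboveAt : Arc → Arc → ℕ → Set
AboveAt a b p = Σ Pos λ s → Σ Pos λ t → Side a p s × Side b p t × Higher s t

-- a and b cannot be drawn without crossing in their interiors:
-- a is forced above b somewhere and below b somewhere else.
Cross : Arc → Arc → Set
Cross a b = Σ ℕ λ p → Σ ℕ λ q → AboveAt a b p × AboveAt b a q

-- Arc diagrams: finite sets of arcs, represented by lists (only membership
-- matters; see `SameSet`).

Diagram : Set
Diagram = List Arc

SameSet : Diagram → Diagram → Set
SameSet δ δ' = (a : Arc) → (a ∈ δ → a ∈ δ') × (a ∈ δ' → a ∈ δ)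

_⊆_ : Diagram → Diagram → Set
δ ⊆ δ' = (a : Arc) → a ∈ δ → a ∈ δ'

NoncrossingDiagram : ℕ → Diagram → Set
NoncrossingDiagram n δ =
  ((a : Arc) → a ∈ δ → InRange n a) ×
  ((a b : Arc) → a ∈ δ → b ∈ δ → a ≢ b →
     (left a ≢ left b) × (right a ≢ right b) × ¬ Cross a b)

SortableDiagram : ℕ → Diagram → Set
SortableDiagram n δ = NoncrossingDiagram n δ × ((a : Arc) → a ∈ δ → Sortable a)

MAD : ℕ → Diagram → Set
MAD n δ = SortableDiagram n δ ×
          ((δ' : Diagram) → SortableDiagram n δ' → δ ⊆ δ' → δ' ⊆ δ)

data Step : Set where
  U D H : Step

isU : Step → Bool
isU U = true
isU _ = false

isD : Step → Bool
isD D = true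
isD _ = false

#U : List Step → ℕ
#U w = length (filter (λ s → isU s Data.Bool.≟ true) w)
  where import Data.Bool

#D : List Step → ℕ
#D w = length (filter (λ s → isD s Data.Bool.≟ true) w)
  where import Data.Bool

Motzkin : ℕ → List Step → Set
Motzkin m w =
  (length w ≡ m) × (#U w ≡ #D w) ×
  ((xs ys : List Step) → w ≡ xs ++ ys → #D xs ≤ #U xs)

PeakOfHeight1 : List Step → Set
PeakOfHeight1 w = Σ (List Step) λ xs → Σ (List Step) λ ys →
  (w ≡ xs ++ (U ∷ D ∷ ys)) × (#U (xs ++ (U ∷ [])) ≡ #D (xs ++ (U ∷ [])) + 1)

Mbar : ℕ → List Step → Set
Mbar m w = Motzkin m w × ¬ PeakOfHeight1 w

isRightEnd : Diagram → ℕ → Bool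
isRightEnd δ p = any (λ a → right a ≡ᵇ p) δ

isLeftEnd : Diagram → ℕ → Bool
isLeftEnd δ p = any (λ a → left a ≡ᵇ p) δ

-- the i-th letter, i ∈ {1,…,n+1}
Ψstep : ℕ → Diagram → ℕ → Step
Ψstep n δ i =
  if (i Data.Nat.≤ᵇ n) Data.Bool.∧ Data.Bool.not (isRightEnd δ (suc i)) then U
  else if (2 Data.Nat.≤ᵇ i) Data.Bool.∧ Data.Bool.not (isLeftEnd δ (i Data.Nat.∸ 1)) then D
  else H
  where import Data.Nat; import Data.Bool

Ψ : ℕ → Diagram → List Step
Ψ n δ = map (λ k → Ψstep n δ (suc k)) (upTo (suc n))

module Submission where

-- Ψ δ records the endpoints of δ: letter i is U iff i+1 is not a right endpoint and D iff i-1 is not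
-- a left endpoint, and for maximal δ these cases exclude each other (otherwise the arc i-1 → i+1 could
-- be added).  Two sortable arcs fit into one diagram iff their endpoints satisfy a parity condition
-- (Compatible); with it, a noncrossing sortable diagram is determined by its endpoint sets, which gives
-- injectivity.  Counting endpoints, the height of Ψ δ never drops below 0, and at a peak UD on the points
-- i, i+1 it is one more than the number of arcs passing over both points, so a peak of height 1 would
-- let us add the arc i → i+1.  Conversely, the endpoint sets read off a path in M̄ can be matched
-- noncrossingly by a left-to-right sweep that keeps the open left endpoints in a deque, and a sortable
-- diagram with the two properties above admits no further arc, so it is maximal.

open import Defs
open import Data.Bool using (Bool; true; false; not; _∧_; if_then_else_; T)
import Data.Bool.Properties as Bool
open import Data.Bool.ListAction using (any)
open import Data.Empty using (⊥; ⊥-elim)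
open import Data.Fin using (toℕ; fromℕ<)
open import Data.Fin.Properties using (toℕ<n; toℕ-fromℕ<)
open import Data.List using (List; []; _∷_; _++_; _∷ʳ_; length; filter; applyUpTo; map; deduplicate)
open import Data.List.Properties
  using (length-++; filter-++; applyUpTo-∷ʳ; length-applyUpTo; ∷-injectiveˡ; ∷-injectiveʳ; ++-assoc; map-upTo;
         filter-some; filter-none; filter-all)
open import Data.List.Membership.Propositional using (_∈_; find; lose)
open import Data.List.Membership.Propositional.Properties
  using (∈-filter⁻; ∈-deduplicate⁺; ∈-deduplicate⁻; ∈-++⁺ˡ; ∈-++⁺ʳ; ∈-++⁻; ∈-map⁺; ∈-map⁻)
open import Data.List.Relation.Unary.All using (All; []; _∷_)
import Data.List.Relation.Unary.All as All
import Data.List.Relation.Unary.All.Properties as All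
open import Data.List.Relation.Unary.AllPairs using (AllPairs; []; _∷_)
import Data.List.Relation.Unary.AllPairs.Properties as AllPairs
open import Data.List.Relation.Unary.Any using (here; there; any?)
open import Data.List.Relation.Unary.Any.Properties using (any⁺; any⁻)
open import Data.List.Relation.Unary.Unique.Propositional using (Unique)
import Data.List.Relation.Unary.Unique.Propositional.Properties as Unique
import Data.List.Relation.Unary.Unique.DecPropositional.Properties as UniqueDec
open import Data.List.Reverse using (reverseView; []; _∶_∶ʳ_)
open import Data.Nat
open import Data.Nat.Induction using (<-rec)
open import Data.Nat.Properties
open import Algebra.Properties.CommutativeSemigroup +-commutativeSemigroup using (interchange)
open import Data.Product using (Σ; _×_; _,_; proj₁; proj₂; uncurry; swap)
open import Data.Sum using (_⊎_; inj₁; inj₂; [_,_]; map₁)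
open import Data.Vec using (tabulate; lookup)
open import Data.Vec.Properties using (lookup∘tabulate; tabulate∘lookup; tabulate-cong)
import Data.Vec.Properties as Vec
open import Function using (_∘_; _∘′_; Equivalence; case_of_)
open import Relation.Binary.Definitions using (DecidableEquality; tri<; tri≈; tri>)
open import Relation.Binary.PropositionalEquality hiding ([_])
open import Relation.Nullary using (¬_; yes; no)
open import Relation.Nullary.Decidable using (_×-dec_)
open import Relation.Nullary.Reflects using (Reflects; ofʸ; ofⁿ; fromEquivalence; det)
open import Relation.Unary using (Decidable)

odd-suc : ∀ m → odd (suc m) ≡ not (odd m)
odd-suc m with odd m
... | true  = refl
... | false = refl

odd-suc-suc : ∀ m → odd (suc (suc m)) ≡ odd m
odd-suc-suc m = trans (odd-suc (suc m)) (trans (cong not (odd-suc m)) (Bool.not-involutive (odd m)))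

odd-suc-≢ : ∀ m → odd (suc m) ≢ odd m
odd-suc-≢ m e = Bool.not-¬ e (odd-suc m)

left<right : ∀ a → left a < right a
left<right a = m<m+n (left a) z<s

sortableArc : ℕ → ℕ → Arc
sortableArc i j = arc i (j ∸ suc i) (tabulate (λ k → odd (i + suc (toℕ k))))

sortableArc-sortable : ∀ i j → Sortable (sortableArc i j)
sortableArc-sortable i j = lookup∘tabulate _

right-sortableArc : ∀ {i j} → i < j → right (sortableArc i j) ≡ j
right-sortableArc {i} i<j = trans (+-suc i _) (m+[n∸m]≡n i<j)

sortable⇒≡sortableArc : ∀ {a} → Sortable a → a ≡ sortableArc (left a) (right a)
sortable⇒≡sortableArc {arc i g s} sa with right (arc i g s) ∸ suc i | gap≡
  where
  gap≡ : right (arc i g s) ∸ suc i ≡ g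
  gap≡ = trans (cong (_∸ suc i) (+-suc i g)) (m+n∸m≡n i g)
... | .g | refl = cong (arc i g) (trans (sym (tabulate∘lookup s)) (tabulate-cong sa))

sortable-unique : ∀ {a b} → Sortable a → Sortable b →
                  left a ≡ left b → right a ≡ right b → a ≡ b
sortable-unique {a} {b} sa sb refl eʳ =
  trans (sortable⇒≡sortableArc sa) (trans (cong (sortableArc (left a)) eʳ) (sym (sortable⇒≡sortableArc sb)))

-- Crossings of sortable arcs

posOf : Bool → Pos
posOf b = if b then Above else Below

IsEnd : Arc → ℕ → Set
IsEnd a p = p ≡ left a ⊎ p ≡ right a

Inside : Arc → ℕ → Set
Inside a p = left a < p × p < right a

side-end : ∀ {a p} → IsEnd a p → Side a p At
side-end (inj₁ refl) = at-left
side-end (inj₂ refl) = at-right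

side-inside : ∀ {a p} → Sortable a → Inside a p → Side a p (posOf (odd p))
side-inside {a} {p} sa (l<p , p<r) = subst₂ (Side a) k-point k-side (interior k)
  where
  k<gap : p ∸ suc (left a) < gap a
  k<gap = +-cancelˡ-< (suc (left a)) _ _
            (subst (_< suc (left a) + gap a) (sym (m+[n∸m]≡n l<p)) (subst (p <_) (+-suc (left a) (gap a)) p<r))
  k = fromℕ< k<gap
  k-point : left a + suc (toℕ k) ≡ p
  k-point = trans (cong (λ t → left a + suc t) (toℕ-fromℕ< k<gap)) (trans (+-suc (left a) _) (m+[n∸m]≡n l<p))
  k-side : posOf (lookup (sides a) k) ≡ posOf (odd p)
  k-side = cong posOf (trans (sa k) (cong odd k-point))

side-sortable : ∀ {a p s} → Sortable a → Side a p s →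
                (IsEnd a p × s ≡ At) ⊎ (Inside a p × s ≡ posOf (odd p))
side-sortable sa at-left = inj₁ (inj₁ refl , refl)
side-sortable sa at-right = inj₁ (inj₂ refl , refl)
side-sortable {a} sa (interior k) =
  inj₂ ((m<m+n (left a) z<s , +-monoʳ-< (left a) (s<s (toℕ<n k))) , cong posOf (sa k))

data Over (a b : Arc) (p : ℕ) : Set where
  above-end : Inside a p → IsEnd b p → odd p ≡ true → Over a b p
  below-end : IsEnd a p → Inside b p → odd p ≡ false → Over a b p

Over⇒AboveAt : ∀ {a b p} → Sortable a → Sortable b → Over a b p → AboveAt a b p
Over⇒AboveAt {a} {b} {p} sa sb (above-end ins end o) =
  Above , At , subst (Side a p) (cong posOf o) (side-inside sa ins) , side-end end , ab-at
Over⇒AboveAt {a} {b} {p} sa sb (below-end end ins o) =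
  At , Below , side-end end , subst (Side b p) (cong posOf o) (side-inside sb ins) , at-be

Above≡posOf : ∀ {b} → Above ≡ posOf b → b ≡ true
Above≡posOf {true} _ = refl

Below≡posOf : ∀ {b} → Below ≡ posOf b → b ≡ false
Below≡posOf {false} _ = refl

Higher-irrefl : ∀ {s} → ¬ Higher s s
Higher-irrefl ()

AboveAt⇒Over : ∀ {a b p} → Sortable a → Sortable b → AboveAt a b p → Over a b p
AboveAt⇒Over {a} {b} {p} sa sb (s , t , sᵃ , tᵇ , h) = go (side-sortable sa sᵃ) (side-sortable sb tᵇ) h
  where
  go : ∀ {s t} → (IsEnd a p × s ≡ At) ⊎ (Inside a p × s ≡ posOf (odd p)) →
                 (IsEnd b p × t ≡ At) ⊎ (Inside b p × t ≡ posOf (odd p)) → Higher s t → Over a b p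
  go (inj₁ (_ , refl)) (inj₁ (_ , refl)) ()
  go (inj₁ (end , refl)) (inj₂ (ins , e)) at-be = below-end end ins (Below≡posOf e)
  go (inj₂ (ins , e)) (inj₁ (end , refl)) ab-at = above-end ins end (Above≡posOf e)
  go (inj₂ (_ , refl)) (inj₂ (_ , refl)) h = ⊥-elim (Higher-irrefl h)

ends : Arc → ℕ × ℕ
ends a = left a , right a

-- A sortable
-- arc passes above exactly the odd points, so overlapping arcs cross iff k and j have the same
-- parity, and nested arcs cross iff k and l have different parities.
data Compatible< : ℕ × ℕ → ℕ × ℕ → Set where
  disjoint    : ∀ {i j k l} → i < k → j ≤ k → Compatible< (i , j) (k , l)
  overlapping : ∀ {i j k l} → i < k → k < j → j < l → odd k ≢ odd j → Compatible< (i , j) (k , l)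
  nested      : ∀ {i j k l} → i < k → l < j → odd k ≡ odd l → Compatible< (i , j) (k , l)

Compatible : ℕ × ℕ → ℕ × ℕ → Set
Compatible c d = Compatible< c d ⊎ Compatible< d c

Separated : Arc → Arc → Set
Separated a b = (left a ≢ left b) × (right a ≢ right b) × ¬ Cross a b

module _ {a b : Arc} (sa : Sortable a) (sb : Sortable b) where

  private
    i = left a
    j = right a
    k = left b
    l = right b

  disjoint-¬Over : ∀ {p} → j ≤ k → ¬ Over a b p
  disjoint-¬Over j≤k (above-end (_ , p<j) (inj₁ refl) _) = <⇒≱ p<j j≤k
  disjoint-¬Over j≤k (above-end (_ , p<j) (inj₂ refl) _) = <⇒≱ p<j (≤-trans j≤k (<⇒≤ (left<right b)))
  disjoint-¬Over j≤k (below-end (inj₁ refl) (k<p , _) _) = <⇒≱ k<p (≤-trans (<⇒≤ (left<right a)) j≤k)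
  disjoint-¬Over j≤k (below-end (inj₂ refl) (k<p , _) _) = <⇒≱ k<p j≤k

  overlapping-Over : ∀ {p} → i < k → j < l → Over a b p → odd k ≡ true ⊎ odd j ≡ false
  overlapping-Over i<k j<l (above-end _ (inj₁ refl) o) = inj₁ o
  overlapping-Over i<k j<l (above-end (_ , p<j) (inj₂ refl) _) = ⊥-elim (<-asym p<j j<l)
  overlapping-Over i<k j<l (below-end (inj₁ refl) (k<p , _) _) = ⊥-elim (<-asym i<k k<p)
  overlapping-Over i<k j<l (below-end (inj₂ refl) _ o) = inj₂ o

  overlapping-Over⁻ : ∀ {q} → i < k → j < l → Over b a q → odd j ≡ true ⊎ odd k ≡ false
  overlapping-Over⁻ i<k j<l (above-end (k<q , _) (inj₁ refl) _) = ⊥-elim (<-asym i<k k<q)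
  overlapping-Over⁻ i<k j<l (above-end _ (inj₂ refl) o) = inj₁ o
  overlapping-Over⁻ i<k j<l (below-end (inj₁ refl) _ o) = inj₂ o
  overlapping-Over⁻ i<k j<l (below-end (inj₂ refl) (_ , q<j) _) = ⊥-elim (<-asym q<j j<l)

  nested-Over : ∀ {p} → i < k → l < j → Over a b p → odd k ≡ true ⊎ odd l ≡ true
  nested-Over i<k l<j (above-end _ (inj₁ refl) o) = inj₁ o
  nested-Over i<k l<j (above-end _ (inj₂ refl) o) = inj₂ o
  nested-Over i<k l<j (below-end (inj₁ refl) (k<p , _) _) = ⊥-elim (<-asym i<k k<p)
  nested-Over i<k l<j (below-end (inj₂ refl) (_ , p<l) _) = ⊥-elim (<-asym l<j p<l)

  nested-Over⁻ : ∀ {q} → i < k → l < j → Over b a q → odd k ≡ false ⊎ odd l ≡ false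
  nested-Over⁻ i<k l<j (above-end (k<q , _) (inj₁ refl) _) = ⊥-elim (<-asym i<k k<q)
  nested-Over⁻ i<k l<j (above-end (_ , q<l) (inj₂ refl) _) = ⊥-elim (<-asym l<j q<l)
  nested-Over⁻ i<k l<j (below-end (inj₁ refl) _ o) = inj₁ o
  nested-Over⁻ i<k l<j (below-end (inj₂ refl) _ o) = inj₂ o

  compatible<⇒¬Cross : Compatible< (ends a) (ends b) → ¬ Cross a b
  compatible<⇒¬Cross c (p , q , ab , ba) = go c (AboveAt⇒Over sa sb ab) (AboveAt⇒Over sb sa ba)
    where
    go : Compatible< (ends a) (ends b) → Over a b p → Over b a q → ⊥
    go (disjoint _ j≤k) x _ = disjoint-¬Over j≤k x
    go (overlapping i<k _ j<l k≢j) x y with overlapping-Over i<k j<l x | overlapping-Over⁻ i<k j<l y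
    ... | inj₁ kᵗ | inj₁ jᵗ = k≢j (trans kᵗ (sym jᵗ))
    ... | inj₁ kᵗ | inj₂ kᶠ = Bool.not-¬ kᵗ kᶠ
    ... | inj₂ jᶠ | inj₁ jᵗ = Bool.not-¬ jᵗ jᶠ
    ... | inj₂ jᶠ | inj₂ kᶠ = k≢j (trans kᶠ (sym jᶠ))
    go (nested i<k l<j k≡l) x y with nested-Over i<k l<j x | nested-Over⁻ i<k l<j y
    ... | inj₁ kᵗ | inj₁ kᶠ = Bool.not-¬ kᵗ kᶠ
    ... | inj₁ kᵗ | inj₂ lᶠ = Bool.not-¬ (trans (sym k≡l) kᵗ) lᶠ
    ... | inj₂ lᵗ | inj₁ kᶠ = Bool.not-¬ (trans k≡l lᵗ) kᶠ
    ... | inj₂ lᵗ | inj₂ lᶠ = Bool.not-¬ lᵗ lᶠ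

  overlapping-Cross : i < k → k < j → j < l → odd k ≡ odd j → Cross a b
  overlapping-Cross i<k k<j j<l k≡j with odd k in kᵒ
  ... | true  = k , j , Over⇒AboveAt sa sb (above-end (i<k , k<j) (inj₁ refl) kᵒ)
                      , Over⇒AboveAt sb sa (above-end (k<j , j<l) (inj₂ refl) (sym k≡j))
  ... | false = j , k , Over⇒AboveAt sa sb (below-end (inj₂ refl) (k<j , j<l) (sym k≡j))
                      , Over⇒AboveAt sb sa (below-end (inj₁ refl) (i<k , k<j) kᵒ)

  nested-Cross : i < k → l < j → odd k ≢ odd l → Cross a b
  nested-Cross i<k l<j k≢l with odd k in kᵒ | odd l in lᵒ
  ... | true  | true  = ⊥-elim (k≢l refl)
  ... | false | false = ⊥-elim (k≢l refl)
  ... | true  | false = k , l , Over⇒AboveAt sa sb (above-end (i<k , <-trans (left<right b) l<j) (inj₁ refl) kᵒ)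
                             , Over⇒AboveAt sb sa (below-end (inj₂ refl) (<-trans i<k (left<right b) , l<j) lᵒ)
  ... | false | true  = l , k , Over⇒AboveAt sa sb (above-end (<-trans i<k (left<right b) , l<j) (inj₂ refl) lᵒ)
                             , Over⇒AboveAt sb sa (below-end (inj₁ refl) (i<k , <-trans (left<right b) l<j) kᵒ)

Cross-sym : ∀ {a b} → Cross a b → Cross b a
Cross-sym (p , q , ab , ba) = q , p , ba , ab

compatible<-ends : ∀ {i j k l} → k < l → Compatible< (i , j) (k , l) → i < k × j ≢ l
compatible<-ends k<l (disjoint i<k j≤k) = i<k , <⇒≢ (≤-<-trans j≤k k<l)
compatible<-ends k<l (overlapping i<k _ j<l _) = i<k , <⇒≢ j<l
compatible<-ends k<l (nested i<k l<j _) = i<k , >⇒≢ l<j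

compatible-distinct : ∀ {i j k l} → i < j → k < l → Compatible (i , j) (k , l) → i ≢ k × j ≢ l
compatible-distinct _ k<l (inj₁ c) = let (i<k , j≢l) = compatible<-ends k<l c in <⇒≢ i<k , j≢l
compatible-distinct i<j _ (inj₂ c) = let (k<i , l≢j) = compatible<-ends i<j c in >⇒≢ k<i , ≢-sym l≢j

compatible⇒separated : ∀ {a b} → Sortable a → Sortable b → Compatible (ends a) (ends b) → Separated a b
compatible⇒separated {a} {b} sa sb c =
  let (i≢k , j≢l) = compatible-distinct (left<right a) (left<right b) c in i≢k , j≢l , ¬cross c
  where
  ¬cross : Compatible (ends a) (ends b) → ¬ Cross a b
  ¬cross (inj₁ c) = compatible<⇒¬Cross sa sb c
  ¬cross (inj₂ c) = compatible<⇒¬Cross sb sa c ∘′ Cross-sym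

separated⇒compatible< : ∀ {a b} → Sortable a → Sortable b → left a < left b → right a ≢ right b →
                        ¬ Cross a b → Compatible< (ends a) (ends b)
separated⇒compatible< {a} {b} sa sb i<k j≢l ¬cross with right a ≤? left b
... | yes j≤k = disjoint i<k j≤k
... | no j≰k with <-cmp (right a) (right b) | odd (left b) Bool.≟ odd (right a)
...   | tri< j<l _ _ | yes k≡j = ⊥-elim (¬cross (overlapping-Cross sa sb i<k (≰⇒> j≰k) j<l k≡j))
...   | tri< j<l _ _ | no k≢j = overlapping i<k (≰⇒> j≰k) j<l k≢j
...   | tri≈ _ j≡l _ | _ = ⊥-elim (j≢l j≡l)
...   | tri> _ _ l<j | _ with odd (left b) Bool.≟ odd (right b)
...     | yes k≡l = nested i<k l<j k≡l
...     | no k≢l = ⊥-elim (¬cross (nested-Cross sa sb i<k l<j k≢l))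

separated⇒compatible : ∀ {a b} → Sortable a → Sortable b → Separated a b → Compatible (ends a) (ends b)
separated⇒compatible {a} {b} sa sb (i≢k , j≢l , ¬cross) with <-cmp (left a) (left b)
... | tri< i<k _ _ = inj₁ (separated⇒compatible< sa sb i<k j≢l ¬cross)
... | tri≈ _ i≡k _ = ⊥-elim (i≢k i≡k)
... | tri> _ _ k<i = inj₂ (separated⇒compatible< sb sa k<i (≢-sym j≢l) (¬cross ∘′ Cross-sym))

compatible-sym : ∀ {c d} → Compatible c d → Compatible d c
compatible-sym (inj₁ c) = inj₂ c
compatible-sym (inj₂ c) = inj₁ c

compatible-short : ∀ {m i j} → i < j → i ≢ m → j ≢ suc (suc m) → Compatible (m , suc (suc m)) (i , j)
compatible-short {m} {i} {j} i<j i≢m j≢ssm with <-cmp i m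
... | tri≈ _ i≡m _ = ⊥-elim (i≢m i≡m)
... | tri< i<m _ _ with <-cmp j (suc m)
...   | tri< j<sm _ _ = inj₂ (disjoint i<m (≤-pred j<sm))
...   | tri≈ _ refl _ = inj₂ (overlapping i<m ≤-refl ≤-refl (odd-suc-≢ m ∘′ sym))
...   | tri> _ _ sm<j = inj₂ (nested i<m (≤∧≢⇒< sm<j (≢-sym j≢ssm)) (sym (odd-suc-suc m)))
compatible-short {m} {i} {j} i<j i≢m j≢ssm | tri> _ _ m<i with m≤n⇒m<n∨m≡n m<i
... | inj₁ sm<i = inj₁ (disjoint m<i sm<i)
... | inj₂ refl = inj₁ (overlapping m<i ≤-refl (≤∧≢⇒< i<j (≢-sym j≢ssm)) (odd-suc-≢ (suc m) ∘′ sym))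

compatible-unit : ∀ {m i j} → i < j → i ≢ m → j ≢ suc m → ¬ (i < m × suc m < j) →
                  Compatible (m , suc m) (i , j)
compatible-unit {m} {i} {j} i<j i≢m j≢sm ¬spans with <-cmp i m
... | tri< i<m _ _ = inj₂ (disjoint i<m (≤-pred (≤∧≢⇒< (≮⇒≥ λ sm<j → ¬spans (i<m , sm<j)) j≢sm)))
... | tri≈ _ i≡m _ = ⊥-elim (i≢m i≡m)
... | tri> _ _ m<i = inj₁ (disjoint m<i m<i)

unit-¬compatible-spanning : ∀ {m i j} → i < m → suc m < j → ¬ Compatible (m , suc m) (i , j)
unit-¬compatible-spanning i<m _ (inj₁ (disjoint m<i _)) = <-asym i<m m<i
unit-¬compatible-spanning i<m _ (inj₁ (overlapping m<i _ _ _)) = <-asym i<m m<i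
unit-¬compatible-spanning i<m _ (inj₁ (nested m<i _ _)) = <-asym i<m m<i
unit-¬compatible-spanning _ sm<j (inj₂ (disjoint _ j≤m)) = <⇒≱ sm<j (m≤n⇒m≤1+n j≤m)
unit-¬compatible-spanning _ sm<j (inj₂ (overlapping _ _ j<sm _)) = <-asym sm<j j<sm
unit-¬compatible-spanning {m} _ _ (inj₂ (nested _ _ m≡sm)) = odd-suc-≢ m (sym m≡sm)

¬compatible-through-short : ∀ {i j k} → k < suc (suc i) → suc (suc i) < j →
                            ¬ Compatible (i , j) (k , suc (suc i))
¬compatible-through-short {i} k<ssi ssi<j (inj₁ (disjoint _ j≤k)) = <⇒≱ (<-trans k<ssi ssi<j) j≤k
¬compatible-through-short {i} k<ssi ssi<j (inj₁ (overlapping _ _ j<ssi _)) = <-asym ssi<j j<ssi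
¬compatible-through-short {i} k<ssi ssi<j (inj₁ (nested {k = k} i<k _ k≡ssi)) with m≤n⇒m<n∨m≡n i<k
... | inj₁ si<k = <⇒≱ k<ssi si<k
... | inj₂ refl = odd-suc-≢ (suc i) (sym k≡ssi)
¬compatible-through-short {i} k<ssi ssi<j (inj₂ (disjoint _ ssi≤i)) = <⇒≱ (m<n+m i z<s) ssi≤i
¬compatible-through-short {i} k<ssi ssi<j (inj₂ (overlapping _ i<ssi _ i≢ssi)) = i≢ssi (sym (odd-suc-suc i))
¬compatible-through-short {i} k<ssi ssi<j (inj₂ (nested _ j<ssi _)) = <-asym ssi<j j<ssi

compatible-longer : ∀ {u v j j₁} → u < j → v < j → j < j₁ → Compatible (u , j) (v , j₁) →
                    (u < v × odd v ≢ odd j) ⊎ (v < u × odd u ≡ odd j)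
compatible-longer _ v<j _ (inj₁ (disjoint _ j≤v)) = ⊥-elim (<⇒≱ v<j j≤v)
compatible-longer _ _ _ (inj₁ (overlapping u<v _ _ v≢j)) = inj₁ (u<v , v≢j)
compatible-longer _ _ j<j₁ (inj₁ (nested _ j₁<j _)) = ⊥-elim (<-asym j<j₁ j₁<j)
compatible-longer u<j _ j<j₁ (inj₂ (disjoint _ j₁≤u)) = ⊥-elim (<⇒≱ (<-trans u<j j<j₁) j₁≤u)
compatible-longer _ _ j<j₁ (inj₂ (overlapping _ _ j₁<j _)) = ⊥-elim (<-asym j<j₁ j₁<j)
compatible-longer _ _ _ (inj₂ (nested v<u _ u≡j)) = inj₂ (v<u , u≡j)

¬compatible-exchange : ∀ {u v j j₁ j₂} → u < j → v < j → j < j₁ → j < j₂ →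
                       Compatible (u , j) (v , j₁) → ¬ Compatible (u , j₂) (v , j)
¬compatible-exchange u<j v<j j<j₁ j<j₂ c c′
  with compatible-longer u<j v<j j<j₁ c | compatible-longer v<j u<j j<j₂ (compatible-sym c′)
... | inj₁ (u<v , _) | inj₁ (v<u , _) = <-asym u<v v<u
... | inj₁ (_ , v≢j) | inj₂ (_ , v≡j) = v≢j v≡j
... | inj₂ (_ , u≡j) | inj₁ (_ , u≢j) = u≢j u≡j
... | inj₂ (v<u , _) | inj₂ (u<v , _) = <-asym u<v v<u

LeftEnd : Diagram → ℕ → Set
LeftEnd δ p = Σ Arc λ a → a ∈ δ × left a ≡ p

RightEnd : Diagram → ℕ → Set
RightEnd δ p = Σ Arc λ a → a ∈ δ × right a ≡ p

anyEnd-reflects : ∀ (end : Arc → ℕ) δ p →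
                  Reflects (Σ Arc λ a → a ∈ δ × end a ≡ p) (any (λ a → end a ≡ᵇ p) δ)
anyEnd-reflects end δ p = fromEquivalence
  (λ t → let (a , a∈δ , e) = find (any⁻ _ δ t) in a , a∈δ , ≡ᵇ⇒≡ (end a) p e)
  (λ (a , a∈δ , e) → any⁺ _ (lose a∈δ (≡⇒≡ᵇ (end a) p e)))

reflects-true⇒ : ∀ {P : Set} {b} → Reflects P b → b ≡ true → P
reflects-true⇒ (ofʸ p) _ = p

reflects-false⇒ : ∀ {P : Set} {b} → Reflects P b → b ≡ false → ¬ P
reflects-false⇒ (ofⁿ ¬p) _ = ¬p

reflects⇒true : ∀ {P : Set} {b} → Reflects P b → P → b ≡ true
reflects⇒true (ofʸ _) _ = refl
reflects⇒true (ofⁿ ¬p) p = ⊥-elim (¬p p)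

reflects⇒false : ∀ {P : Set} {b} → Reflects P b → ¬ P → b ≡ false
reflects⇒false (ofʸ p) ¬p = ⊥-elim (¬p p)
reflects⇒false (ofⁿ _) _ = refl

∧-true : ∀ {a b} → a ∧ b ≡ true → a ≡ true × b ≡ true
∧-true {true} {true} _ = refl , refl

isLeftEnd-true⇒ : ∀ {δ p} → isLeftEnd δ p ≡ true → LeftEnd δ p
isLeftEnd-true⇒ {δ} {p} = reflects-true⇒ (anyEnd-reflects left δ p)

isLeftEnd-false⇒ : ∀ {δ p a} → isLeftEnd δ p ≡ false → a ∈ δ → left a ≢ p
isLeftEnd-false⇒ {δ} {p} {a} e a∈δ eq = reflects-false⇒ (anyEnd-reflects left δ p) e (a , a∈δ , eq)

isLeftEnd-∈ : ∀ {δ a} → a ∈ δ → isLeftEnd δ (left a) ≡ true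
isLeftEnd-∈ {δ} {a} a∈δ = reflects⇒true (anyEnd-reflects left δ (left a)) (a , a∈δ , refl)

isRightEnd-true⇒ : ∀ {δ p} → isRightEnd δ p ≡ true → RightEnd δ p
isRightEnd-true⇒ {δ} {p} = reflects-true⇒ (anyEnd-reflects right δ p)

isRightEnd-false⇒ : ∀ {δ p a} → isRightEnd δ p ≡ false → a ∈ δ → right a ≢ p
isRightEnd-false⇒ {δ} {p} {a} e a∈δ eq = reflects-false⇒ (anyEnd-reflects right δ p) e (a , a∈δ , eq)

isRightEnd-∈ : ∀ {δ a} → a ∈ δ → isRightEnd δ (right a) ≡ true
isRightEnd-∈ {δ} {a} a∈δ = reflects⇒true (anyEnd-reflects right δ (right a)) (a , a∈δ , refl)

isU-isD-injective : ∀ {s t} → isU s ≡ isU t → isD s ≡ isD t → s ≡ t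
isU-isD-injective {U} {U} _ _ = refl
isU-isD-injective {D} {D} _ _ = refl
isU-isD-injective {H} {H} _ _ = refl
isU-isD-injective {U} {D} () _
isU-isD-injective {U} {H} () _
isU-isD-injective {D} {U} () _
isU-isD-injective {H} {U} () _
isU-isD-injective {D} {H} _ ()
isU-isD-injective {H} {D} _ ()

isU-true : ∀ {s} → isU s ≡ true → s ≡ U
isU-true {U} _ = refl

isD-true : ∀ {s} → isD s ≡ true → s ≡ D
isD-true {D} _ = refl

module _ (n : ℕ) (δ : Diagram) (i : ℕ) where

  isU-Ψstep : isU (Ψstep n δ i) ≡ (i ≤ᵇ n) ∧ not (isRightEnd δ (suc i))
  isU-Ψstep with (i ≤ᵇ n) ∧ not (isRightEnd δ (suc i))
  ... | true = refl
  ... | false with (2 ≤ᵇ i) ∧ not (isLeftEnd δ (i ∸ 1))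
  ...   | true = refl
  ...   | false = refl

  isD-Ψstep : isD (Ψstep n δ i) ≡
              not ((i ≤ᵇ n) ∧ not (isRightEnd δ (suc i))) ∧ ((2 ≤ᵇ i) ∧ not (isLeftEnd δ (i ∸ 1)))
  isD-Ψstep with (i ≤ᵇ n) ∧ not (isRightEnd δ (suc i))
  ... | true = refl
  ... | false with (2 ≤ᵇ i) ∧ not (isLeftEnd δ (i ∸ 1))
  ...   | true = refl
  ...   | false = refl

bit : Bool → ℕ
bit true  = 1
bit false = 0

bit-complement : ∀ {b c} → b ≡ not c → bit b + bit c ≡ 1
bit-complement {c = true} refl = refl
bit-complement {c = false} refl = refl

bit≤1 : ∀ b → bit b ≤ 1
bit≤1 true = ≤-refl
bit≤1 false = z≤n

#U-++ : ∀ xs ys → #U (xs ++ ys) ≡ #U xs + #U ys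
#U-++ xs ys = trans (cong length (filter-++ _ xs ys)) (length-++ (filter _ xs))

#D-++ : ∀ xs ys → #D (xs ++ ys) ≡ #D xs + #D ys
#D-++ xs ys = trans (cong length (filter-++ _ xs ys)) (length-++ (filter _ xs))

#U-∷ʳ : ∀ xs s → #U (xs ++ s ∷ []) ≡ #U xs + bit (isU s)
#U-∷ʳ xs U = #U-++ xs (U ∷ [])
#U-∷ʳ xs D = #U-++ xs (D ∷ [])
#U-∷ʳ xs H = #U-++ xs (H ∷ [])

#D-∷ʳ : ∀ xs s → #D (xs ++ s ∷ []) ≡ #D xs + bit (isD s)
#D-∷ʳ xs U = #D-++ xs (U ∷ [])
#D-∷ʳ xs D = #D-++ xs (D ∷ [])
#D-∷ʳ xs H = #D-++ xs (H ∷ [])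

length-∷ʳ : ∀ {A : Set} (xs : List A) x → length (xs ++ x ∷ []) ≡ suc (length xs)
length-∷ʳ xs x = trans (length-++ xs) (+-comm _ 1)

module _ {A : Set} where

  applyUpTo-suc : ∀ (f : ℕ → A) m → applyUpTo f (suc m) ≡ applyUpTo f m ++ f m ∷ []
  applyUpTo-suc f m = sym (applyUpTo-∷ʳ f m)

  applyUpTo-++ : ∀ (f : ℕ → A) {i m} → i ≤ m →
                 applyUpTo f m ≡ applyUpTo f i ++ applyUpTo (λ k → f (i + k)) (m ∸ i)
  applyUpTo-++ f {zero} _ = refl
  applyUpTo-++ f {suc i} {suc m} (s≤s i≤m) = cong (f 0 ∷_) (applyUpTo-++ (λ k → f (suc k)) i≤m)

  applyUpTo-cong : ∀ {f g : ℕ → A} m → (∀ k → k < m → f k ≡ g k) → applyUpTo f m ≡ applyUpTo g m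
  applyUpTo-cong zero _ = refl
  applyUpTo-cong (suc m) f≗g = cong₂ _∷_ (f≗g 0 z<s) (applyUpTo-cong m (λ k k<m → f≗g (suc k) (s<s k<m)))

  applyUpTo-injective : ∀ {f g : ℕ → A} m → applyUpTo f m ≡ applyUpTo g m → ∀ k → k < m → f k ≡ g k
  applyUpTo-injective (suc m) e zero _ = ∷-injectiveˡ e
  applyUpTo-injective (suc m) e (suc k) (s<s k<m) = applyUpTo-injective m (∷-injectiveʳ e) k k<m

  prefix-applyUpTo : ∀ (f : ℕ → A) m xs ys → applyUpTo f m ≡ xs ++ ys →
                     xs ≡ applyUpTo f (length xs) × length xs ≤ m
  prefix-applyUpTo f m [] ys e = refl , z≤n
  prefix-applyUpTo f (suc m) (x ∷ xs) ys e =
    let (xs≡ , ≤m) = prefix-applyUpTo (λ k → f (suc k)) m xs ys (∷-injectiveʳ e)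
    in cong₂ _∷_ (sym (∷-injectiveˡ e)) xs≡ , s≤s ≤m

  applyUpTo-lookup : ∀ (f : ℕ → A) m xs y ys → applyUpTo f m ≡ xs ++ y ∷ ys → f (length xs) ≡ y
  applyUpTo-lookup f (suc m) [] y ys e = ∷-injectiveˡ e
  applyUpTo-lookup f (suc m) (x ∷ xs) y ys e = applyUpTo-lookup (λ k → f (suc k)) m xs y ys (∷-injectiveʳ e)

letter : List Step → ℕ → Step
letter [] _ = H
letter (s ∷ w) zero = s
letter (s ∷ w) (suc k) = letter w k

applyUpTo-letter : ∀ w → w ≡ applyUpTo (letter w) (length w)
applyUpTo-letter [] = refl
applyUpTo-letter (s ∷ w) = cong (s ∷_) (applyUpTo-letter w)

Ψ≡applyUpTo : ∀ n δ → Ψ n δ ≡ applyUpTo (λ k → Ψstep n δ (suc k)) (suc n)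
Ψ≡applyUpTo n δ = map-upTo _ (suc n)

module _ (f : ℕ → Step) where

  ups downs : ℕ → ℕ
  ups i = #U (applyUpTo f i)
  downs i = #D (applyUpTo f i)

  ups-suc : ∀ i → ups (suc i) ≡ ups i + bit (isU (f i))
  ups-suc i = trans (cong #U (applyUpTo-suc f i)) (#U-∷ʳ (applyUpTo f i) (f i))

  downs-suc : ∀ i → downs (suc i) ≡ downs i + bit (isD (f i))
  downs-suc i = trans (cong #D (applyUpTo-suc f i)) (#D-∷ʳ (applyUpTo f i) (f i))

  motzkin-applyUpTo : ∀ m → (∀ i → i ≤ m → downs i ≤ ups i) → ups m ≡ downs m →
                      Motzkin m (applyUpTo f m)
  motzkin-applyUpTo m balanced total = length-applyUpTo f m , total , λ xs ys e →
    let (xs≡ , ≤m) = prefix-applyUpTo f m xs ys e in subst (λ z → #D z ≤ #U z) (sym xs≡) (balanced _ ≤m)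

  motzkin-prefix : ∀ {m} → Motzkin m (applyUpTo f m) → ∀ i → i ≤ m → downs i ≤ ups i
  motzkin-prefix (_ , _ , prefixes) i i≤m = prefixes (applyUpTo f i) _ (applyUpTo-++ f i≤m)

  -- letters k and k+1 (0-based) form a peak of height 1
  PeakAt : ℕ → Set
  PeakAt k = f k ≡ U × f (suc k) ≡ D × ups (suc k) ≡ downs (suc k) + 1

  peak⇒PeakAt : ∀ m → PeakOfHeight1 (applyUpTo f m) → Σ ℕ λ k → suc (suc k) ≤ m × PeakAt k
  peak⇒PeakAt m (xs , ys , e , height) =
    length xs , ≤m , fk≡U , fsk≡D , subst (λ z → #U z ≡ #D z + 1) xsU≡ height
    where
    e' : applyUpTo f m ≡ (xs ++ U ∷ []) ++ D ∷ ys
    e' = trans e (sym (++-assoc xs (U ∷ []) (D ∷ ys)))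
    e'' : applyUpTo f m ≡ ((xs ++ U ∷ []) ++ D ∷ []) ++ ys
    e'' = trans e' (sym (++-assoc (xs ++ U ∷ []) (D ∷ []) ys))
    fk≡U : f (length xs) ≡ U
    fk≡U = applyUpTo-lookup f m xs U (D ∷ ys) e
    fsk≡D : f (suc (length xs)) ≡ D
    fsk≡D = subst (λ k → f k ≡ D) (length-∷ʳ xs U) (applyUpTo-lookup f m (xs ++ U ∷ []) D ys e')
    xsU≡ : xs ++ U ∷ [] ≡ applyUpTo f (suc (length xs))
    xsU≡ = subst (λ k → xs ++ U ∷ [] ≡ applyUpTo f k) (length-∷ʳ xs U)
             (proj₁ (prefix-applyUpTo f m (xs ++ U ∷ []) (D ∷ ys) e'))
    ≤m : suc (suc (length xs)) ≤ m
    ≤m = subst (_≤ m) (trans (length-∷ʳ (xs ++ U ∷ []) D) (cong suc (length-∷ʳ xs U)))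
           (proj₂ (prefix-applyUpTo f m ((xs ++ U ∷ []) ++ D ∷ []) ys e''))

  PeakAt⇒peak : ∀ m k → suc (suc k) ≤ m → PeakAt k → PeakOfHeight1 (applyUpTo f m)
  PeakAt⇒peak m k ≤m (fk≡U , fsk≡D , height) =
    applyUpTo f k , rest , split , subst (λ z → #U z ≡ #D z + 1) prefix≡ height
    where
    prefix≡ : applyUpTo f (suc k) ≡ applyUpTo f k ++ U ∷ []
    prefix≡ = trans (applyUpTo-suc f k) (cong (λ s → applyUpTo f k ++ s ∷ []) fk≡U)
    rest = applyUpTo (λ j → f (suc (suc k) + j)) (m ∸ suc (suc k))
    split : applyUpTo f m ≡ applyUpTo f k ++ U ∷ D ∷ rest
    split = begin
      applyUpTo f m
        ≡⟨ applyUpTo-++ f ≤m ⟩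
      applyUpTo f (suc (suc k)) ++ rest
        ≡⟨ cong (_++ rest) (trans (applyUpTo-suc f (suc k))
                                  (cong₂ (λ xs s → xs ++ s ∷ []) prefix≡ fsk≡D)) ⟩
      ((applyUpTo f k ++ U ∷ []) ++ D ∷ []) ++ rest
        ≡⟨ trans (++-assoc (applyUpTo f k ++ U ∷ []) (D ∷ []) rest)
                 (++-assoc (applyUpTo f k) (U ∷ []) (D ∷ rest)) ⟩
      applyUpTo f k ++ U ∷ D ∷ rest ∎
      where open ≡-Reasoning

module _ {A : Set} where

  count : {P : A → Set} → Decidable P → List A → ℕ
  count P? xs = length (filter P? xs)

  module _ {P : A → Set} (P? : Decidable P) where

    count-pos : ∀ {x xs} → x ∈ xs → P x → 1 ≤ count P? xs
    count-pos x∈xs px = filter-some P? (lose x∈xs px)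

    count-zero : ∀ xs → (∀ {x} → x ∈ xs → ¬ P x) → count P? xs ≡ 0
    count-zero xs none = cong length (filter-none P? (All.tabulate none))

    count-all : ∀ xs → (∀ {x} → x ∈ xs → P x) → count P? xs ≡ length xs
    count-all xs all = cong length (filter-all P? (All.tabulate all))

    count-witness : ∀ xs → 1 ≤ count P? xs → Σ A λ x → x ∈ xs × P x
    count-witness xs pos = go (filter P? xs) (∈-filter⁻ P?) pos
      where
      go : ∀ ys → (∀ {y} → y ∈ ys → y ∈ xs × P y) → 1 ≤ length ys → Σ A λ x → x ∈ xs × P x
      go (y ∷ _) mem _ = y , mem (here refl)

    count-≤1 : ∀ {xs} → Unique xs → (∀ {x y} → x ∈ xs → y ∈ xs → P x → P y → x ≡ y) → count P? xs ≤ 1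
    count-≤1 {xs} unique pinned = go (filter P? xs) (Unique.filter⁺ P? unique) (∈-filter⁻ P?)
      where
      go : ∀ ys → Unique ys → (∀ {y} → y ∈ ys → y ∈ xs × P y) → length ys ≤ 1
      go [] _ _ = z≤n
      go (_ ∷ []) _ _ = ≤-refl
      go (y ∷ z ∷ _) ((y≢z ∷ _) ∷ _) mem =
        let (y∈ , py) = mem (here refl) ; (z∈ , pz) = mem (there (here refl))
        in ⊥-elim (y≢z (pinned y∈ z∈ py pz))

  module _ {P Q R : A → Set} (P? : Decidable P) (Q? : Decidable Q) (R? : Decidable R) where

    count-≤-+ : ∀ xs → (∀ {x} → x ∈ xs → P x → Q x ⊎ R x) → count P? xs ≤ count Q? xs + count R? xs
    count-≤-+ [] _ = z≤n
    count-≤-+ (x ∷ xs) cover with ih ← count-≤-+ xs (cover ∘ there) | P? x | Q? x | R? x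
    ... | yes _ | yes _ | yes _ = s≤s (≤-trans ih (+-monoʳ-≤ (count Q? xs) (n≤1+n _)))
    ... | yes _ | yes _ | no _ = s≤s ih
    ... | yes _ | no _ | yes _ = subst (suc (count P? xs) ≤_) (sym (+-suc (count Q? xs) _)) (s≤s ih)
    ... | yes p | no ¬q | no ¬r = ⊥-elim ([ ¬q , ¬r ] (cover (here refl) p))
    ... | no _ | yes _ | yes _ = ≤-trans ih (≤-trans (n≤1+n _) (s≤s (+-monoʳ-≤ (count Q? xs) (n≤1+n _))))
    ... | no _ | yes _ | no _ = ≤-trans ih (n≤1+n _)
    ... | no _ | no _ | yes _ = ≤-trans ih (+-monoʳ-≤ (count Q? xs) (n≤1+n _))
    ... | no _ | no _ | no _ = ih

    count-+-≤ : ∀ xs → (∀ {x} → x ∈ xs → Q x ⊎ R x → P x) → (∀ {x} → x ∈ xs → Q x → ¬ R x) →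
                count Q? xs + count R? xs ≤ count P? xs
    count-+-≤ [] _ _ = z≤n
    count-+-≤ (x ∷ xs) into apart with ih ← count-+-≤ xs (into ∘ there) (apart ∘ there) | P? x | Q? x | R? x
    ... | _ | yes q | yes r = ⊥-elim (apart (here refl) q r)
    ... | yes _ | yes _ | no _ = s≤s ih
    ... | yes _ | no _ | yes _ = subst (_≤ suc (count P? xs)) (sym (+-suc (count Q? xs) _)) (s≤s ih)
    ... | yes _ | no _ | no _ = ≤-trans ih (n≤1+n _)
    ... | no ¬p | yes q | no _ = ⊥-elim (¬p (into (here refl) (inj₁ q)))
    ... | no ¬p | no _ | yes r = ⊥-elim (¬p (into (here refl) (inj₂ r)))
    ... | no _ | no _ | no _ = ih

decArc : DecidableEquality Arc
decArc (arc i g s) (arc i′ g′ s′) with i ≟ i′ | g ≟ g′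
... | no i≢i′ | _ = no λ { refl → i≢i′ refl }
... | yes refl | no g≢g′ = no λ { refl → g≢g′ refl }
... | yes refl | yes refl with Vec.≡-dec Bool._≟_ s s′
...   | yes refl = yes refl
...   | no s≢s′ = no λ { refl → s≢s′ refl }

module _ {n δ} (sd : SortableDiagram n δ) where

  ∈-inRange : ∀ {a} → a ∈ δ → InRange n a
  ∈-inRange = proj₁ (proj₁ sd) _

  ∈-sortable : ∀ {a} → a ∈ δ → Sortable a
  ∈-sortable = proj₂ sd _

  ∈-separated : ∀ {a b} → a ∈ δ → b ∈ δ → a ≢ b → Separated a b
  ∈-separated = proj₂ (proj₁ sd) _ _

  ∈-compatible : ∀ {a b} → a ∈ δ → b ∈ δ → a ≢ b → Compatible (ends a) (ends b)
  ∈-compatible a∈δ b∈δ a≢b =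
    separated⇒compatible (∈-sortable a∈δ) (∈-sortable b∈δ) (∈-separated a∈δ b∈δ a≢b)

  left-injective : ∀ {a b} → a ∈ δ → b ∈ δ → left a ≡ left b → a ≡ b
  left-injective {a} {b} a∈δ b∈δ eˡ with right a ≟ right b
  ... | yes eʳ = sortable-unique (∈-sortable a∈δ) (∈-sortable b∈δ) eˡ eʳ
  ... | no r≢ = ⊥-elim (proj₁ (∈-separated a∈δ b∈δ (r≢ ∘ cong right)) eˡ)

  right-injective : ∀ {a b} → a ∈ δ → b ∈ δ → right a ≡ right b → a ≡ b
  right-injective {a} {b} a∈δ b∈δ eʳ with left a ≟ left b
  ... | yes eˡ = sortable-unique (∈-sortable a∈δ) (∈-sortable b∈δ) eˡ eʳ
  ... | no l≢ = ⊥-elim (proj₁ (proj₂ (∈-separated a∈δ b∈δ (l≢ ∘ cong left))) eʳ)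

  isLeftEnd-outside : ∀ {p} → p ≡ 0 ⊎ n < p → isLeftEnd δ p ≡ false
  isLeftEnd-outside {p} out = reflects⇒false (anyEnd-reflects left δ p) (no-arc out)
    where
    no-arc : p ≡ 0 ⊎ n < p → ¬ LeftEnd δ p
    no-arc (inj₁ refl) (a , a∈δ , l≡0) = <⇒≱ (proj₁ (∈-inRange a∈δ)) (≤-reflexive l≡0)
    no-arc (inj₂ n<p) (a , a∈δ , refl) = <⇒≱ n<p (≤-pred (≤-trans (left<right a) (proj₂ (∈-inRange a∈δ))))

  isRightEnd-outside : ∀ {p} → p ≤ 1 ⊎ suc n < p → isRightEnd δ p ≡ false
  isRightEnd-outside {p} out = reflects⇒false (anyEnd-reflects right δ p) (no-arc out)
    where
    no-arc : p ≤ 1 ⊎ suc n < p → ¬ RightEnd δ p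
    no-arc (inj₁ p≤1) (a , a∈δ , refl) = <⇒≱ (≤-<-trans (proj₁ (∈-inRange a∈δ)) (left<right a)) p≤1
    no-arc (inj₂ sn<p) (a , a∈δ , refl) = <⇒≱ sn<p (proj₂ (∈-inRange a∈δ))

mad-insert : ∀ {n δ e} → MAD n δ → Sortable e → InRange n e →
             (∀ {b} → b ∈ δ → Compatible (ends e) (ends b)) → e ∈ δ
mad-insert {n} {δ} {e} (((inR , nc) , srt) , maximal) se inRᵉ compatible =
  maximal (e ∷ δ) ((inR′ , nc′) , srt′) (λ _ → there) e (here refl)
  where
  inR′ : ∀ a → a ∈ e ∷ δ → InRange n a
  inR′ a (here refl) = inRᵉ
  inR′ a (there a∈δ) = inR a a∈δ
  srt′ : ∀ a → a ∈ e ∷ δ → Sortable a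
  srt′ a (here refl) = se
  srt′ a (there a∈δ) = srt a a∈δ
  nc′ : ∀ a b → a ∈ e ∷ δ → b ∈ e ∷ δ → a ≢ b → Separated a b
  nc′ a b (here refl) (here refl) a≢b = ⊥-elim (a≢b refl)
  nc′ a b (here refl) (there b∈δ) _ = compatible⇒separated se (srt b b∈δ) (compatible b∈δ)
  nc′ a b (there a∈δ) (here refl) _ = compatible⇒separated (srt a a∈δ) se (compatible-sym (compatible a∈δ))
  nc′ a b (there a∈δ) (there b∈δ) a≢b = nc a b a∈δ b∈δ a≢b

mad-insert-sortableArc : ∀ {n δ i j} → MAD n δ → i < j → 1 ≤ i → j ≤ suc n →
                         (∀ {b} → b ∈ δ → Compatible (i , j) (ends b)) → sortableArc i j ∈ δ
mad-insert-sortableArc {n} {δ} {i} {j} mad i<j 1≤i j≤sn compatible =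
  mad-insert mad (sortableArc-sortable i j) (1≤i , subst (_≤ suc n) (sym rʲ) j≤sn)
    (λ b∈δ → subst (λ r → Compatible (i , r) _) (sym rʲ) (compatible b∈δ))
  where rʲ = right-sortableArc i<j

-- the first two clauses in the definition of Ψ never apply at the same point
UDExclusive : ℕ → Diagram → Set
UDExclusive n δ = ∀ m → 1 ≤ m → suc m ≤ n → isLeftEnd δ m ≡ false → isRightEnd δ (suc (suc m)) ≡ true

mad⇒UDExclusive : ∀ {n δ} → MAD n δ → UDExclusive n δ
mad⇒UDExclusive {n} {δ} mad m 1≤m sm≤n lᶠ with isRightEnd δ (suc (suc m)) in rᶠ
... | true = refl
... | false = ⊥-elim (Bool.not-¬ (isLeftEnd-∈ short∈δ) lᶠ)
  where
  short∈δ : sortableArc m (suc (suc m)) ∈ δ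
  short∈δ = mad-insert-sortableArc mad (m<n⇒m<1+n (n<1+n m)) 1≤m (s≤s sm≤n)
      λ {b} b∈δ → compatible-short (left<right b) (isLeftEnd-false⇒ lᶠ b∈δ) (isRightEnd-false⇒ rᶠ b∈δ)

module _ (n : ℕ) (δ : Diagram) where

  isU-Ψstep-≤ : ∀ {i} → i ≤ n → isU (Ψstep n δ i) ≡ not (isRightEnd δ (suc i))
  isU-Ψstep-≤ {i} i≤n =
    trans (isU-Ψstep n δ i) (cong (_∧ not (isRightEnd δ (suc i))) (reflects⇒true (≤ᵇ-reflects-≤ i n) i≤n))

  isU-Ψstep-last : isU (Ψstep n δ (suc n)) ≡ false
  isU-Ψstep-last = trans (isU-Ψstep n δ (suc n))
    (cong (_∧ not (isRightEnd δ (suc (suc n)))) (reflects⇒false (≤ᵇ-reflects-≤ (suc n) n) 1+n≰n))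

  isD-Ψstep-first : isD (Ψstep n δ 1) ≡ false
  isD-Ψstep-first = trans (isD-Ψstep n δ 1) (Bool.∧-zeroʳ _)

  isD-Ψstep-≤ : UDExclusive n δ → ∀ {m} → suc m ≤ n →
                isD (Ψstep n δ (suc (suc m))) ≡ not (isLeftEnd δ (suc m))
  isD-Ψstep-≤ excl {m} sm≤n = trans (isD-Ψstep n δ (suc (suc m))) (clauses _ _ _ conflict)
    where
    clauses : ∀ c r l → (l ≡ false → c ≡ true → r ≡ true) → not (c ∧ not r) ∧ (true ∧ not l) ≡ not l
    clauses c r true _ = Bool.∧-zeroʳ _
    clauses false r false _ = refl
    clauses true r false excl′ rewrite excl′ refl refl = refl
    conflict : isLeftEnd δ (suc m) ≡ false → (suc (suc m) ≤ᵇ n) ≡ true →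
               isRightEnd δ (suc (suc (suc m))) ≡ true
    conflict lᶠ c = excl (suc m) (s≤s z≤n) (reflects-true⇒ (≤ᵇ-reflects-≤ _ n) c) lᶠ

-- Ψ of a maximal diagram lies in M̄

complement-≤ : ∀ {a b c d} → a + b ≡ c + d → b ≤ d → c ≤ a
complement-≤ {a} {b} {c} {d} e b≤d = +-cancelʳ-≤ b c a (begin
  c + b ≤⟨ +-monoʳ-≤ c b≤d ⟩
  c + d ≡⟨ e ⟨
  a + b ∎)
  where open ≤-Reasoning

module EndpointCount {n δ} (sd : SortableDiagram n δ) where

  arcs : List Arc
  arcs = deduplicate decArc δ

  ∈arcs⁻ : ∀ {a} → a ∈ arcs → a ∈ δ
  ∈arcs⁻ = ∈-deduplicate⁻ decArc δ

  module _ (end : Arc → ℕ) (end-injective : ∀ {a b} → a ∈ δ → b ∈ δ → end a ≡ end b → a ≡ b) where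

    #endAt : ∀ p → count (λ a → end a ≟ p) arcs ≡ bit (any (λ a → end a ≡ᵇ p) δ)
    #endAt p with any (λ a → end a ≡ᵇ p) δ | anyEnd-reflects end δ p
    ... | true | ofʸ (a , a∈δ , e) =
      ≤-antisym (count-≤1 _ (UniqueDec.deduplicate-! decArc δ) pinned)
                (count-pos _ (∈-deduplicate⁺ decArc a∈δ) e)
      where
      pinned : ∀ {x y} → x ∈ arcs → y ∈ arcs → end x ≡ p → end y ≡ p → x ≡ y
      pinned x∈ y∈ ex ey = end-injective (∈arcs⁻ x∈) (∈arcs⁻ y∈) (trans ex (sym ey))
    ... | false | ofⁿ none = count-zero _ arcs (λ a∈ e → none (_ , ∈arcs⁻ a∈ , e))

    #end≤ : ℕ → ℕ
    #end≤ g = count (λ a → end a ≤? g) arcs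

    #end≤-suc : ∀ g → #end≤ (suc g) ≡ #end≤ g + bit (any (λ a → end a ≡ᵇ suc g) δ)
    #end≤-suc g = trans
      (≤-antisym (count-≤-+ _ _ _ arcs (λ _ → map₁ ≤-pred ∘ m≤n⇒m<n∨m≡n))
                 (count-+-≤ _ _ _ arcs (λ { _ (inj₁ ≤g) → m≤n⇒m≤1+n ≤g ; _ (inj₂ e) → ≤-reflexive e })
                                       (λ { _ ≤g e → 1+n≰n (subst (_≤ g) e ≤g) })))
      (cong (#end≤ g +_) (#endAt (suc g)))

  #left≤ #right≤ : ℕ → ℕ
  #left≤ = #end≤ left (left-injective sd)
  #right≤ = #end≤ right (right-injective sd)

  #left≤-0 : #left≤ 0 ≡ 0
  #left≤-0 = count-zero _ arcs λ a∈ l≤0 → <⇒≱ (proj₁ (∈-inRange sd (∈arcs⁻ a∈))) l≤0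

  #right≤-1 : #right≤ 1 ≡ 0
  #right≤-1 = count-zero _ arcs λ {a} a∈ r≤1 →
    <⇒≱ (≤-<-trans (proj₁ (∈-inRange sd (∈arcs⁻ a∈))) (left<right a)) r≤1

  #left≤≡#right≤ : #left≤ n ≡ #right≤ (suc n)
  #left≤≡#right≤ =
    trans (count-all _ arcs λ {a} a∈ → ≤-pred (≤-trans (left<right a) (proj₂ (∈-inRange sd (∈arcs⁻ a∈)))))
          (sym (count-all _ arcs λ a∈ → proj₂ (∈-inRange sd (∈arcs⁻ a∈))))

  #right≤-≤ : ∀ m → #right≤ (suc (suc m)) ≤ #left≤ m + 1
  #right≤-≤ m = ≤-trans (count-≤-+ _ _ (λ a → left a ≟ suc m) arcs starts)
    (+-monoʳ-≤ (#left≤ m) (≤-trans (≤-reflexive (#endAt left (left-injective sd) (suc m))) (bit≤1 _)))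
    where
    starts : ∀ {a} → a ∈ arcs → right a ≤ suc (suc m) → left a ≤ m ⊎ left a ≡ suc m
    starts {a} _ r≤ = map₁ ≤-pred (m≤n⇒m<n∨m≡n (≤-pred (≤-trans (left<right a) r≤)))

  Spans : ℕ → Arc → Set
  Spans m a = left a ≤ m × suc (suc m) < right a

  #spans : ℕ → ℕ
  #spans m = count (λ a → (left a ≤? m) ×-dec (suc (suc m) <? right a)) arcs

  #left≤≡#right≤+#spans : ∀ m → isLeftEnd δ (suc m) ≡ false →
                          #left≤ m ≡ #right≤ (suc (suc m)) + #spans m
  #left≤≡#right≤+#spans m lᶠ = ≤-antisym (count-≤-+ _ _ _ arcs ends-or-spans)
                                         (count-+-≤ _ _ _ arcs starts λ _ r≤ (_ , ssm<r) → <⇒≱ ssm<r r≤)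
    where
    ends-or-spans : ∀ {a} → a ∈ arcs → left a ≤ m → right a ≤ suc (suc m) ⊎ Spans m a
    ends-or-spans {a} _ l≤m with suc (suc m) <? right a
    ... | yes ssm<r = inj₂ (l≤m , ssm<r)
    ... | no ssm≮r = inj₁ (≮⇒≥ ssm≮r)
    starts : ∀ {a} → a ∈ arcs → right a ≤ suc (suc m) ⊎ Spans m a → left a ≤ m
    starts _ (inj₂ (l≤m , _)) = l≤m
    starts {a} a∈ (inj₁ r≤) with m≤n⇒m<n∨m≡n (≤-pred (≤-trans (left<right a) r≤))
    ... | inj₁ l<sm = ≤-pred l<sm
    ... | inj₂ l≡sm = ⊥-elim (isLeftEnd-false⇒ lᶠ (∈arcs⁻ a∈) l≡sm)

  spanning-arc : ∀ m → 1 ≤ #spans m → Σ Arc λ a → a ∈ δ × Spans m a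
  spanning-arc m pos = let (a , a∈ , spans) = count-witness _ arcs pos in a , ∈arcs⁻ a∈ , spans

  ψ : ℕ → Step
  ψ k = Ψstep n δ (suc k)

  ups-+-#right≤ : ∀ i → i ≤ n → ups ψ i + #right≤ (suc i) ≡ i
  ups-+-#right≤ zero _ = #right≤-1
  ups-+-#right≤ (suc i) si≤n = begin
    ups ψ (suc i) + #right≤ (suc (suc i))
      ≡⟨ cong₂ _+_ (ups-suc ψ i) (#end≤-suc right (right-injective sd) (suc i)) ⟩
    (ups ψ i + bit (isU (ψ i))) + (#right≤ (suc i) + bit (isRightEnd δ (suc (suc i))))
      ≡⟨ interchange (ups ψ i) _ _ _ ⟩
    (ups ψ i + #right≤ (suc i)) + (bit (isU (ψ i)) + bit (isRightEnd δ (suc (suc i))))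
      ≡⟨ cong₂ _+_ (ups-+-#right≤ i (<⇒≤ si≤n))
                   (bit-complement (isU-Ψstep-≤ n δ si≤n)) ⟩
    i + 1
      ≡⟨ +-comm i 1 ⟩
    suc i ∎
    where open ≡-Reasoning

  downs-+-#left≤ : UDExclusive n δ → ∀ m → m ≤ n → downs ψ (suc m) + #left≤ m ≡ m
  downs-+-#left≤ _ zero _ = cong₂ _+_ (trans (downs-suc ψ 0) (cong bit (isD-Ψstep-first n δ))) #left≤-0
  downs-+-#left≤ excl (suc m) sm≤n = begin
    downs ψ (suc (suc m)) + #left≤ (suc m)
      ≡⟨ cong₂ _+_ (downs-suc ψ (suc m)) (#end≤-suc left (left-injective sd) m) ⟩
    (downs ψ (suc m) + bit (isD (ψ (suc m)))) + (#left≤ m + bit (isLeftEnd δ (suc m)))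
      ≡⟨ interchange (downs ψ (suc m)) _ _ _ ⟩
    (downs ψ (suc m) + #left≤ m) + (bit (isD (ψ (suc m))) + bit (isLeftEnd δ (suc m)))
      ≡⟨ cong₂ _+_ (downs-+-#left≤ excl m (<⇒≤ sm≤n))
                   (bit-complement (isD-Ψstep-≤ n δ excl sm≤n)) ⟩
    m + 1
      ≡⟨ +-comm m 1 ⟩
    suc m ∎
    where open ≡-Reasoning

  height : UDExclusive n δ → ∀ m → suc m ≤ n →
           ups ψ (suc m) + #right≤ (suc (suc m)) ≡ downs ψ (suc m) + suc (#left≤ m)
  height excl m sm≤n =
    trans (ups-+-#right≤ (suc m) sm≤n)
          (sym (trans (+-suc _ _) (cong suc (downs-+-#left≤ excl m (<⇒≤ sm≤n)))))

  Ψ-motzkin : UDExclusive n δ → Motzkin (suc n) (Ψ n δ)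
  Ψ-motzkin excl = subst (Motzkin (suc n)) (sym (Ψ≡applyUpTo n δ)) (motzkin-applyUpTo ψ (suc n) balanced total)
    where
    total : ups ψ (suc n) ≡ downs ψ (suc n)
    total = +-cancelʳ-≡ (#right≤ (suc n)) _ _ (begin
      ups ψ (suc n) + #right≤ (suc n)     ≡⟨ cong (_+ #right≤ (suc n)) (ups-suc ψ n) ⟩
      (ups ψ n + bit (isU (ψ n))) + #right≤ (suc n)
                                          ≡⟨ cong (λ b → ups ψ n + bit b + #right≤ (suc n)) (isU-Ψstep-last n δ) ⟩
      (ups ψ n + 0) + #right≤ (suc n)     ≡⟨ cong (_+ #right≤ (suc n)) (+-identityʳ _) ⟩
      ups ψ n + #right≤ (suc n)           ≡⟨ ups-+-#right≤ n ≤-refl ⟩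
      n                                   ≡⟨ downs-+-#left≤ excl n ≤-refl ⟨
      downs ψ (suc n) + #left≤ n          ≡⟨ cong (downs ψ (suc n) +_) #left≤≡#right≤ ⟩
      downs ψ (suc n) + #right≤ (suc n)   ∎)
      where open ≡-Reasoning
    balanced : ∀ i → i ≤ suc n → downs ψ i ≤ ups ψ i
    balanced zero _ = z≤n
    balanced (suc m) sm≤sn with m≤n⇒m<n∨m≡n sm≤sn
    ... | inj₂ refl = ≤-reflexive (sym total)
    ... | inj₁ (s≤s sm≤n) =
      complement-≤ (height excl m sm≤n) (subst (#right≤ (suc (suc m)) ≤_) (+-comm (#left≤ m) 1) (#right≤-≤ m))

  height-spans : UDExclusive n δ → ∀ m → suc m ≤ n → isLeftEnd δ (suc m) ≡ false →
                 ups ψ (suc m) ≡ downs ψ (suc m) + suc (#spans m)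
  height-spans excl m sm≤n lᶠ = +-cancelʳ-≡ R _ _ (begin
    ups ψ (suc m) + R              ≡⟨ height excl m sm≤n ⟩
    d + suc (#left≤ m)             ≡⟨ cong (λ x → d + suc x) (#left≤≡#right≤+#spans m lᶠ) ⟩
    d + suc (R + #spans m)         ≡⟨ cong (λ x → d + suc x) (+-comm R (#spans m)) ⟩
    d + (suc (#spans m) + R)       ≡⟨ +-assoc d _ R ⟨
    d + suc (#spans m) + R         ∎)
    where
    open ≡-Reasoning
    R = #right≤ (suc (suc m))
    d = downs ψ (suc m)

module _ {n δ} (mad : MAD n δ) where

  open EndpointCount (proj₁ mad)

  -- a peak of height 1 means that no arc passes over its two points, so the arc joining them could be added
  ¬PeakAt : ∀ k → suc (suc k) ≤ suc n → ¬ PeakAt ψ k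
  ¬PeakAt k (s≤s sk≤n) (ψk≡U , ψsk≡D , height1) = Bool.not-¬ (isLeftEnd-∈ unit∈δ) lᶠ
    where
    excl = mad⇒UDExclusive mad
    rᶠ : isRightEnd δ (suc (suc k)) ≡ false
    rᶠ = Bool.not-injective (trans (sym (isU-Ψstep-≤ n δ sk≤n)) (cong isU ψk≡U))
    lᶠ : isLeftEnd δ (suc k) ≡ false
    lᶠ = Bool.not-injective (trans (sym (isD-Ψstep-≤ n δ excl sk≤n)) (cong isD ψsk≡D))
    no-spans : #spans k ≡ 0
    no-spans = suc-injective (+-cancelˡ-≡ (downs ψ (suc k)) _ _
                                           (trans (sym (height-spans excl k sk≤n lᶠ)) height1))
    ¬spanning : ∀ {b} → b ∈ δ → ¬ Spans k b
    ¬spanning b∈δ spans = <⇒≱ (count-pos _ (∈-deduplicate⁺ decArc b∈δ) spans) (≤-reflexive no-spans)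
    unit∈δ : sortableArc (suc k) (suc (suc k)) ∈ δ
    unit∈δ = mad-insert-sortableArc mad ≤-refl (s≤s z≤n) (s≤s sk≤n) λ {b} b∈δ →
      compatible-unit (left<right b) (isLeftEnd-false⇒ lᶠ b∈δ) (isRightEnd-false⇒ rᶠ b∈δ)
        (λ (l<sk , ssk<r) → ¬spanning b∈δ (≤-pred l<sk , ssk<r))

  Ψ-noPeak : ¬ PeakOfHeight1 (Ψ n δ)
  Ψ-noPeak peak =
    let (k , ≤sn , peakAt) = peak⇒PeakAt ψ (suc n) (subst PeakOfHeight1 (Ψ≡applyUpTo n δ) peak)
    in ¬PeakAt k ≤sn peakAt

Ψ-Mbar : ∀ {n δ} → MAD n δ → Mbar (suc n) (Ψ n δ)
Ψ-Mbar mad = EndpointCount.Ψ-motzkin (proj₁ mad) (mad⇒UDExclusive mad) , Ψ-noPeak mad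

-- Injectivity

Ending⊆ : ℕ → Diagram → Diagram → Set
Ending⊆ j A B = ∀ {a} → a ∈ A → right a ≡ j → a ∈ B

Ending≡ : ℕ → Diagram → Diagram → Set
Ending≡ j A B = Ending⊆ j A B × Ending⊆ j B A

-- Induction on the right endpoint j.  Let a ∈ A end at j, let a′ ∈ B start and b ∈ B end where a
-- does.  If a′ ended after j, the arc b″ ∈ A starting where b does would end after j as well, and
-- a, b″ ∈ A together with a′, b ∈ B would form the configuration excluded by ¬compatible-exchange.
module _ {n n′ A B} (sdA : SortableDiagram n A) (sdB : SortableDiagram n′ B)
         (sameL : ∀ p → isLeftEnd A p ≡ isLeftEnd B p) (sameR : ∀ p → isRightEnd A p ≡ isRightEnd B p) where

  partner-starts-elsewhere : ∀ {a a′ b} → a′ ∈ B → b ∈ B → left a′ ≡ left a → right b ≡ right a →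
                             right a < right a′ → left b ≢ left a
  partner-starts-elsewhere a′∈B b∈B la′ rb r<r′ e =
    <⇒≢ r<r′ (trans (sym rb) (cong right (left-injective sdB b∈B a′∈B (trans e (sym la′)))))

  longer-partner : ∀ {a a′ b} → (∀ {j′} → j′ < right a → Ending≡ j′ A B) → a ∈ A → a′ ∈ B → b ∈ B →
                   left a′ ≡ left a → right b ≡ right a → right a < right a′ → ⊥
  longer-partner {a} {a′} {b} below a∈A a′∈B b∈B la′ rb r<r′
    with isLeftEnd-true⇒ (trans (sameL (left b)) (isLeftEnd-∈ b∈B))
  ... | b″ , b″∈A , lb″ with <-cmp (right b″) (right a)
  ...   | tri≈ _ r″≡r _ = elsewhere (trans (sym lb″) (cong left (right-injective sdA b″∈A a∈A r″≡r)))
    where elsewhere = partner-starts-elsewhere {a} a′∈B b∈B la′ rb r<r′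
  ...   | tri< r″<r _ _ = <⇒≢ r″<r (trans (cong right (left-injective sdB (proj₁ (below r″<r) b″∈A refl) b∈B lb″)) rb)
  ...   | tri> _ _ r<r″ = ¬compatible-exchange (left<right a) (subst (left b <_) rb (left<right b)) r<r″ r<r′
          (subst (λ v → Compatible (ends a) (v , right b″)) lb″ (∈-compatible sdA a∈A b″∈A a≢b″))
          (subst₂ (λ u r → Compatible (u , right a′) (left b , r)) la′ rb (∈-compatible sdB a′∈B b∈B a′≢b))
    where
    a≢b″ : a ≢ b″
    a≢b″ e = partner-starts-elsewhere {a} a′∈B b∈B la′ rb r<r′ (trans (sym lb″) (cong left (sym e)))
    a′≢b : a′ ≢ b
    a′≢b e = <⇒≢ r<r′ (trans (sym rb) (cong right (sym e)))

  ending⊆-step : ∀ j → (∀ {j′} → j′ < j → Ending≡ j′ A B) → Ending⊆ j A B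
  ending⊆-step j below {a} a∈A refl
    with isLeftEnd-true⇒ (trans (sym (sameL (left a))) (isLeftEnd-∈ a∈A))
       | isRightEnd-true⇒ (trans (sym (sameR (right a))) (isRightEnd-∈ a∈A))
  ... | a′ , a′∈B , la′ | b , b∈B , rb with <-cmp (right a′) (right a)
  ...   | tri≈ _ r′≡r _ = subst (_∈ B) (sortable-unique (∈-sortable sdB a′∈B) (∈-sortable sdA a∈A) la′ r′≡r) a′∈B
  ...   | tri< r′<r _ _ = ⊥-elim (<⇒≢ r′<r (cong right (left-injective sdA (proj₂ (below r′<r) a′∈B refl) a∈A la′)))
  ...   | tri> _ _ r<r′ = ⊥-elim (longer-partner below a∈A a′∈B b∈B la′ rb r<r′)

sameEnds⇒SameSet : ∀ {n n′ A B} → SortableDiagram n A → SortableDiagram n′ B →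
                   (∀ p → isLeftEnd A p ≡ isLeftEnd B p) → (∀ p → isRightEnd A p ≡ isRightEnd B p) →
                   SameSet A B
sameEnds⇒SameSet {A = A} {B} sdA sdB sameL sameR a =
  (λ a∈A → proj₁ (agree (right a)) a∈A refl) , (λ a∈B → proj₂ (agree (right a)) a∈B refl)
  where
  agree : ∀ j → Ending≡ j A B
  agree = <-rec _ λ j below →
    ending⊆-step sdA sdB sameL sameR j below ,
    ending⊆-step sdB sdA (sym ∘ sameL) (sym ∘ sameR) j (swap ∘ below)

module _ {n δ δ′} (mad : MAD n δ) (mad′ : MAD n δ′) (same : Ψ n δ ≡ Ψ n δ′) where

  private
    sameLetter : ∀ {k} → k < suc n → Ψstep n δ (suc k) ≡ Ψstep n δ′ (suc k)
    sameLetter = applyUpTo-injective {f = λ k → Ψstep n δ (suc k)} {g = λ k → Ψstep n δ′ (suc k)} (suc n)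
                   (trans (sym (Ψ≡applyUpTo n δ)) (trans same (Ψ≡applyUpTo n δ′))) _

    sameLeftOutside : ∀ {p} → p ≡ 0 ⊎ n < p → isLeftEnd δ p ≡ isLeftEnd δ′ p
    sameLeftOutside out = trans (isLeftEnd-outside (proj₁ mad) out) (sym (isLeftEnd-outside (proj₁ mad′) out))

    sameRightOutside : ∀ {p} → p ≤ 1 ⊎ suc n < p → isRightEnd δ p ≡ isRightEnd δ′ p
    sameRightOutside out = trans (isRightEnd-outside (proj₁ mad) out) (sym (isRightEnd-outside (proj₁ mad′) out))

  Ψ-sameLeftEnds : ∀ p → isLeftEnd δ p ≡ isLeftEnd δ′ p
  Ψ-sameLeftEnds zero = sameLeftOutside (inj₁ refl)
  Ψ-sameLeftEnds (suc m) with m <? n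
  ... | yes m<n = Bool.not-injective (trans (sym (isD-Ψstep-≤ n δ (mad⇒UDExclusive mad) m<n))
                    (trans (cong isD (sameLetter (s≤s m<n))) (isD-Ψstep-≤ n δ′ (mad⇒UDExclusive mad′) m<n)))
  ... | no m≮n = sameLeftOutside (inj₂ (s≤s (≮⇒≥ m≮n)))

  Ψ-sameRightEnds : ∀ p → isRightEnd δ p ≡ isRightEnd δ′ p
  Ψ-sameRightEnds zero = sameRightOutside (inj₁ z≤n)
  Ψ-sameRightEnds (suc zero) = sameRightOutside (inj₁ ≤-refl)
  Ψ-sameRightEnds (suc (suc m)) with m <? n
  ... | yes m<n = Bool.not-injective (trans (sym (isU-Ψstep-≤ n δ m<n))
                    (trans (cong isU (sameLetter (m<n⇒m<1+n m<n))) (isU-Ψstep-≤ n δ′ m<n)))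
  ... | no m≮n = sameRightOutside (inj₂ (s≤s (s≤s (≮⇒≥ m≮n))))

  Ψ-injective : SameSet δ δ′
  Ψ-injective = sameEnds⇒SameSet (proj₁ mad) (proj₁ mad′) Ψ-sameLeftEnds Ψ-sameRightEnds

-- Sortable diagrams with exclusive clauses and no peak of height 1 are maximal

module _ {n δ} (sd : SortableDiagram n δ) (excl : UDExclusive n δ) (noPeak : ¬ PeakOfHeight1 (Ψ n δ)) where

  open EndpointCount sd

  unit-not-insertable : ∀ {m} → suc m ≤ n → isLeftEnd δ (suc m) ≡ false → isRightEnd δ (suc (suc m)) ≡ false →
                        Σ Arc λ b → b ∈ δ × ¬ Compatible (suc m , suc (suc m)) (ends b)
  unit-not-insertable {m} sm≤n lᶠ rᶠ =
    let (b , b∈δ , l≤m , ssm<r) = spanning-arc m spanning in b , b∈δ , unit-¬compatible-spanning (s≤s l≤m) ssm<r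
    where
    unspanned⇒peak : #spans m ≡ 0 → PeakAt ψ m
    unspanned⇒peak none =
      isU-true (trans (isU-Ψstep-≤ n δ sm≤n) (cong not rᶠ)) ,
      isD-true (trans (isD-Ψstep-≤ n δ excl sm≤n) (cong not lᶠ)) ,
      trans (height-spans excl m sm≤n lᶠ) (cong (λ x → downs ψ (suc m) + suc x) none)
    spanning : 1 ≤ #spans m
    spanning = n≢0⇒n>0 λ none →
      noPeak (subst PeakOfHeight1 (sym (Ψ≡applyUpTo n δ)) (PeakAt⇒peak ψ (suc n) m (s≤s sm≤n) (unspanned⇒peak none)))

  module _ {i j} (i<j : i < j) (compatible : ∀ {b} → b ∈ δ → Compatible (i , j) (ends b)) where

    fresh-left : isLeftEnd δ i ≡ false
    fresh-left = reflects⇒false (anyEnd-reflects left δ i) λ (b , b∈δ , lb) →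
      proj₁ (compatible-distinct i<j (left<right b) (compatible b∈δ)) (sym lb)

    fresh-right : isRightEnd δ j ≡ false
    fresh-right = reflects⇒false (anyEnd-reflects right δ j) λ (b , b∈δ , rb) →
      proj₂ (compatible-distinct i<j (left<right b) (compatible b∈δ)) (sym rb)

  saturated : ∀ {i j} → 1 ≤ i → i < j → j ≤ suc n → ¬ (∀ {b} → b ∈ δ → Compatible (i , j) (ends b))
  saturated {suc m} {j} _ i<j j≤sn compatible with m≤n⇒m<n∨m≡n i<j
  ... | inj₂ refl =
    let (b , b∈δ , incompatible) = unit-not-insertable (≤-pred j≤sn) (fresh-left i<j compatible)
                                                       (fresh-right i<j compatible)
    in incompatible (compatible b∈δ)
  ... | inj₁ ssi<j
    with isRightEnd-true⇒ (excl (suc m) (s≤s z≤n) (≤-pred (≤-trans ssi<j j≤sn)) (fresh-left i<j compatible))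
  ...   | b , b∈δ , rb = ¬compatible-through-short (subst (left b <_) rb (left<right b)) ssi<j′
                           (subst (λ r → Compatible (suc m , j) (left b , r)) rb (compatible b∈δ))
    where
    ssi<j′ : suc (suc (suc m)) < j
    ssi<j′ = ≤∧≢⇒< ssi<j λ ssi≡j →
      Bool.not-¬ (subst (λ p → isRightEnd δ p ≡ true) (trans rb ssi≡j) (isRightEnd-∈ b∈δ))
                 (fresh-right i<j compatible)

  UDExclusive-noPeak⇒MAD : MAD n δ
  UDExclusive-noPeak⇒MAD = sd , maximal
    where
    maximal : (δ′ : Diagram) → SortableDiagram n δ′ → δ ⊆ δ′ → δ′ ⊆ δ
    maximal δ′ sd′ δ⊆δ′ a a∈δ′ with any? (decArc a) δ
    ... | yes a∈δ = a∈δ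
    ... | no a∉δ = ⊥-elim (saturated 1≤l (left<right a) r≤sn λ {b} b∈δ →
                     ∈-compatible sd′ a∈δ′ (δ⊆δ′ b b∈δ) λ a≡b → a∉δ (subst (_∈ δ) (sym a≡b) b∈δ))
      where
      1≤l = proj₁ (∈-inRange sd′ a∈δ′)
      r≤sn = proj₂ (∈-inRange sd′ a∈δ′)

-- Noncrossing matchings with prescribed endpoints

closing-compatible : ∀ {k k′ z z′} → k′ < z → z < z′ →
                     (k < k′ × odd k′ ≢ odd z) ⊎ (k′ < k × odd k ≡ odd z) → Compatible (k , z) (k′ , z′)
closing-compatible k′<z z<z′ (inj₁ (k<k′ , k′≢z)) = inj₁ (overlapping k<k′ k′<z z<z′ k′≢z)
closing-compatible k′<z z<z′ (inj₂ (k′<k , k≡z)) = inj₂ (nested k′<k z<z′ k≡z)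

-- the open left endpoints are kept odd ones first, decreasing, then even ones, increasing
data _≺_ (k₁ k₂ : ℕ) : Set where
  odd-desc : k₂ < k₁ → odd k₁ ≡ true → k₁ ≺ k₂
  even-asc : k₁ < k₂ → odd k₂ ≡ false → k₁ ≺ k₂

allPairs-∷ʳ⁻ : ∀ {A : Set} {R : A → A → Set} xs {x} → AllPairs R (xs ∷ʳ x) → AllPairs R xs × All (λ y → R y x) xs
allPairs-∷ʳ⁻ [] _ = [] , []
allPairs-∷ʳ⁻ (y ∷ xs) (y-xs∷ʳx ∷ rest) =
  let (rest′ , last) = allPairs-∷ʳ⁻ xs rest ; (y-xs , y-x) = All.++⁻ xs y-xs∷ʳx
  in (y-xs ∷ rest′) , (All.head y-x ∷ last)

#≤ : (ℕ → Bool) → ℕ → ℕ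
#≤ P zero = bit (P zero)
#≤ P (suc q) = #≤ P q + bit (P (suc q))

#≤-suc-true : ∀ P {q} → P (suc q) ≡ true → #≤ P (suc q) ≡ suc (#≤ P q)
#≤-suc-true P {q} e = trans (cong (λ b → #≤ P q + bit b) e) (+-comm _ 1)

#≤-suc-false : ∀ P {q} → P (suc q) ≡ false → #≤ P (suc q) ≡ #≤ P q
#≤-suc-false P {q} e = trans (cong (λ b → #≤ P q + bit b) e) (+-identityʳ _)

-- Sweep the points from left to right.  A right endpoint z is joined to the first open left endpoint
-- (in ≺-order) if z is odd and to the last one if z is even; Inv qL qR describes the state once the
-- left endpoints up to qL and the right endpoints up to qR have been processed.
module Matching (L R : ℕ → Bool) where

  record Inv (qL qR : ℕ) (closed : List (ℕ × ℕ)) (open′ : List ℕ) : Set where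
    field
      closed-valid      : ∀ {x y} → (x , y) ∈ closed → x < y × y ≤ qR × L x ≡ true × R y ≡ true
      open-valid        : ∀ {k} → k ∈ open′ → k ≤ qL × L k ≡ true
      closed-compatible : ∀ {c d} → c ∈ closed → d ∈ closed → c ≢ d → Compatible c d
      open-compatible   : ∀ {x y k z} → (x , y) ∈ closed → k ∈ open′ → y < z → Compatible (x , y) (k , z)
      open-ordered      : AllPairs _≺_ open′
      lefts-complete    : ∀ {p} → p ≤ qL → L p ≡ true → (Σ ℕ λ y → (p , y) ∈ closed) ⊎ p ∈ open′
      rights-complete   : ∀ {p} → p ≤ qR → R p ≡ true → Σ ℕ λ x → (x , p) ∈ closed
      open-count        : length open′ + #≤ R qR ≡ #≤ L qL

  open Inv

  skip-right : ∀ {q cl op} → R (suc q) ≡ false → Inv q q cl op → Inv q (suc q) cl op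
  skip-right {q} {cl} {op} rᶠ I = record
    { closed-valid = λ c∈ → let (x<y , y≤q , lx , ry) = closed-valid I c∈ in x<y , m≤n⇒m≤1+n y≤q , lx , ry
    ; open-valid = open-valid I ; closed-compatible = closed-compatible I ; open-compatible = open-compatible I
    ; open-ordered = open-ordered I ; lefts-complete = lefts-complete I
    ; rights-complete = rights-complete′
    ; open-count = trans (cong (length op +_) (#≤-suc-false R rᶠ)) (open-count I) }
    where
    rights-complete′ : ∀ {p} → p ≤ suc q → R p ≡ true → Σ ℕ λ x → (x , p) ∈ cl
    rights-complete′ p≤sq rᵗ with m≤n⇒m<n∨m≡n p≤sq
    ... | inj₁ p<sq = rights-complete I (≤-pred p<sq) rᵗ
    ... | inj₂ refl = ⊥-elim (Bool.not-¬ rᵗ rᶠ)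

  skip-left : ∀ {q cl op} → L (suc q) ≡ false → Inv q (suc q) cl op → Inv (suc q) (suc q) cl op
  skip-left {q} {cl} {op} lᶠ I = record
    { closed-valid = closed-valid I
    ; open-valid = λ k∈ → let (k≤q , lk) = open-valid I k∈ in m≤n⇒m≤1+n k≤q , lk
    ; closed-compatible = closed-compatible I ; open-compatible = open-compatible I
    ; open-ordered = open-ordered I ; lefts-complete = lefts-complete′ ; rights-complete = rights-complete I
    ; open-count = trans (open-count I) (sym (#≤-suc-false L lᶠ)) }
    where
    lefts-complete′ : ∀ {p} → p ≤ suc q → L p ≡ true → (Σ ℕ λ y → (p , y) ∈ cl) ⊎ p ∈ op
    lefts-complete′ p≤sq lᵗ with m≤n⇒m<n∨m≡n p≤sq
    ... | inj₁ p<sq = lefts-complete I (≤-pred p<sq) lᵗ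
    ... | inj₂ refl = ⊥-elim (Bool.not-¬ lᵗ lᶠ)

  close : ∀ {q cl op k rest} → Inv q q cl op → R (suc q) ≡ true →
          k ∈ op → (∀ {k′} → k′ ∈ rest → k′ ∈ op) → (∀ {k′} → k′ ∈ op → k′ ≡ k ⊎ k′ ∈ rest) →
          length op ≡ suc (length rest) → AllPairs _≺_ rest →
          (∀ {k′} → k′ ∈ rest → (k < k′ × odd k′ ≢ odd (suc q)) ⊎ (k′ < k × odd k ≡ odd (suc q))) →
          Inv q (suc q) ((k , suc q) ∷ cl) rest
  close {q} {cl} {op} {k} {rest} I rᵗ k∈op rest⊆op op⊆ |op| ordered parity = record
    { closed-valid = closed-valid′ ; open-valid = open-valid I ∘ rest⊆op
    ; closed-compatible = closed-compatible′ ; open-compatible = open-compatible′ ; open-ordered = ordered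
    ; lefts-complete = lefts-complete′ ; rights-complete = rights-complete′
    ; open-count = begin
        length rest + #≤ R (suc q)       ≡⟨ cong (length rest +_) (#≤-suc-true R rᵗ) ⟩
        length rest + suc (#≤ R q)       ≡⟨ +-suc (length rest) _ ⟩
        suc (length rest) + #≤ R q       ≡⟨ cong (_+ #≤ R q) |op| ⟨
        length op + #≤ R q               ≡⟨ open-count I ⟩
        #≤ L q                           ∎ }
    where
    open ≡-Reasoning
    k≤q = proj₁ (open-valid I k∈op)
    closed-valid′ : ∀ {x y} → (x , y) ∈ (k , suc q) ∷ cl → x < y × y ≤ suc q × L x ≡ true × R y ≡ true
    closed-valid′ (here refl) = s≤s k≤q , ≤-refl , proj₂ (open-valid I k∈op) , rᵗ
    closed-valid′ (there c∈) = let (x<y , y≤q , lx , ry) = closed-valid I c∈ in x<y , m≤n⇒m≤1+n y≤q , lx , ry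
    closed-compatible′ : ∀ {c d} → c ∈ (k , suc q) ∷ cl → d ∈ (k , suc q) ∷ cl → c ≢ d → Compatible c d
    closed-compatible′ (here refl) (here refl) c≢d = ⊥-elim (c≢d refl)
    closed-compatible′ (here refl) (there d∈) _ =
      compatible-sym (open-compatible I d∈ k∈op (s≤s (proj₁ (proj₂ (closed-valid I d∈)))))
    closed-compatible′ (there c∈) (here refl) _ = open-compatible I c∈ k∈op (s≤s (proj₁ (proj₂ (closed-valid I c∈))))
    closed-compatible′ (there c∈) (there d∈) c≢d = closed-compatible I c∈ d∈ c≢d
    open-compatible′ : ∀ {x y k′ z} → (x , y) ∈ (k , suc q) ∷ cl → k′ ∈ rest → y < z → Compatible (x , y) (k′ , z)
    open-compatible′ (here refl) k′∈ sq<z =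
      closing-compatible (s≤s (proj₁ (open-valid I (rest⊆op k′∈)))) sq<z (parity k′∈)
    open-compatible′ (there c∈) k′∈ y<z = open-compatible I c∈ (rest⊆op k′∈) y<z
    lefts-complete′ : ∀ {p} → p ≤ q → L p ≡ true → (Σ ℕ λ y → (p , y) ∈ (k , suc q) ∷ cl) ⊎ p ∈ rest
    lefts-complete′ p≤q lᵗ with lefts-complete I p≤q lᵗ
    ... | inj₁ (y , c∈) = inj₁ (y , there c∈)
    ... | inj₂ p∈op with op⊆ p∈op
    ...   | inj₁ refl = inj₁ (suc q , here refl)
    ...   | inj₂ p∈rest = inj₂ p∈rest
    rights-complete′ : ∀ {p} → p ≤ suc q → R p ≡ true → Σ ℕ λ x → (x , p) ∈ (k , suc q) ∷ cl
    rights-complete′ p≤sq rᵖ with m≤n⇒m<n∨m≡n p≤sq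
    ... | inj₁ p<sq = let (x , c∈) = rights-complete I (≤-pred p<sq) rᵖ in x , there c∈
    ... | inj₂ refl = k , here refl

  close-first : ∀ {q cl k rest} → Inv q q cl (k ∷ rest) → R (suc q) ≡ true → odd (suc q) ≡ true →
                Inv q (suc q) ((k , suc q) ∷ cl) rest
  close-first {q} {cl} {k} {rest} I rᵗ oddᵗ with open-ordered I
  ... | k≺rest ∷ ordered = close I rᵗ (here refl) there split refl ordered parity′
    where
    split : ∀ {k′} → k′ ∈ k ∷ rest → k′ ≡ k ⊎ k′ ∈ rest
    split (here e) = inj₁ e
    split (there k′∈) = inj₂ k′∈
    parity′ : ∀ {k′} → k′ ∈ rest → (k < k′ × odd k′ ≢ odd (suc q)) ⊎ (k′ < k × odd k ≡ odd (suc q))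
    parity′ k′∈ with All.lookup k≺rest k′∈
    ... | odd-desc k′<k kᵗ = inj₂ (k′<k , trans kᵗ (sym oddᵗ))
    ... | even-asc k<k′ k′ᶠ = inj₁ (k<k′ , λ e → Bool.not-¬ k′ᶠ (trans e oddᵗ))

  close-last : ∀ {q cl k rest} → Inv q q cl (rest ∷ʳ k) → R (suc q) ≡ true → odd (suc q) ≡ false →
               Inv q (suc q) ((k , suc q) ∷ cl) rest
  close-last {q} {cl} {k} {rest} I rᵗ oddᶠ with allPairs-∷ʳ⁻ rest (open-ordered I)
  ... | ordered , rest≺k = close I rᵗ (∈-++⁺ʳ rest (here refl)) ∈-++⁺ˡ split (length-∷ʳ rest k) ordered parity′
    where
    split : ∀ {k′} → k′ ∈ rest ∷ʳ k → k′ ≡ k ⊎ k′ ∈ rest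
    split k′∈ with ∈-++⁻ rest k′∈
    ... | inj₁ k′∈rest = inj₂ k′∈rest
    ... | inj₂ (here e) = inj₁ e
    parity′ : ∀ {k′} → k′ ∈ rest → (k < k′ × odd k′ ≢ odd (suc q)) ⊎ (k′ < k × odd k ≡ odd (suc q))
    parity′ k′∈ with All.lookup rest≺k k′∈
    ... | odd-desc k<k′ k′ᵗ = inj₁ (k<k′ , λ e → Bool.not-¬ k′ᵗ (trans e oddᶠ))
    ... | even-asc k′<k kᶠ = inj₂ (k′<k , trans kᶠ (sym oddᶠ))

  open-new : ∀ {q cl op op′} → Inv q (suc q) cl op → L (suc q) ≡ true →
             (∀ {k} → k ∈ op → k ∈ op′) → (∀ {k} → k ∈ op′ → k ≡ suc q ⊎ k ∈ op) → suc q ∈ op′ →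
             length op′ ≡ suc (length op) → AllPairs _≺_ op′ → Inv (suc q) (suc q) cl op′
  open-new {q} {cl} {op} {op′} I lᵗ op⊆ op′⊆ sq∈ |op′| ordered = record
    { closed-valid = closed-valid I ; open-valid = open-valid′ ; closed-compatible = closed-compatible I
    ; open-compatible = open-compatible′ ; open-ordered = ordered
    ; lefts-complete = lefts-complete′ ; rights-complete = rights-complete I
    ; open-count = begin
        length op′ + #≤ R (suc q)        ≡⟨ cong (_+ #≤ R (suc q)) |op′| ⟩
        suc (length op + #≤ R (suc q))   ≡⟨ cong suc (open-count I) ⟩
        suc (#≤ L q)                     ≡⟨ #≤-suc-true L lᵗ ⟨
        #≤ L (suc q)                     ∎ }
    where
    open ≡-Reasoning
    open-valid′ : ∀ {k} → k ∈ op′ → k ≤ suc q × L k ≡ true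
    open-valid′ k∈ with op′⊆ k∈
    ... | inj₁ refl = ≤-refl , lᵗ
    ... | inj₂ k∈op = let (k≤q , lk) = open-valid I k∈op in m≤n⇒m≤1+n k≤q , lk
    open-compatible′ : ∀ {x y k z} → (x , y) ∈ cl → k ∈ op′ → y < z → Compatible (x , y) (k , z)
    open-compatible′ c∈ k∈ y<z with op′⊆ k∈
    ... | inj₁ refl = let (x<y , y≤sq , _) = closed-valid I c∈ in inj₁ (disjoint (<-≤-trans x<y y≤sq) y≤sq)
    ... | inj₂ k∈op = open-compatible I c∈ k∈op y<z
    lefts-complete′ : ∀ {p} → p ≤ suc q → L p ≡ true → (Σ ℕ λ y → (p , y) ∈ cl) ⊎ p ∈ op′
    lefts-complete′ p≤sq lᵖ with m≤n⇒m<n∨m≡n p≤sq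
    ... | inj₂ refl = inj₂ sq∈
    ... | inj₁ p<sq with lefts-complete I (≤-pred p<sq) lᵖ
    ...   | inj₁ closed = inj₁ closed
    ...   | inj₂ p∈op = inj₂ (op⊆ p∈op)

  open-first : ∀ {q cl op} → Inv q (suc q) cl op → L (suc q) ≡ true → odd (suc q) ≡ true →
               Inv (suc q) (suc q) cl (suc q ∷ op)
  open-first {q} {cl} {op} I lᵗ oddᵗ =
    open-new I lᵗ there split (here refl) refl (All.tabulate newest ∷ open-ordered I)
    where
    split : ∀ {k} → k ∈ suc q ∷ op → k ≡ suc q ⊎ k ∈ op
    split (here e) = inj₁ e
    split (there k∈) = inj₂ k∈
    newest : ∀ {k} → k ∈ op → suc q ≺ k
    newest k∈ = odd-desc (s≤s (proj₁ (Inv.open-valid I k∈))) oddᵗ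

  open-last : ∀ {q cl op} → Inv q (suc q) cl op → L (suc q) ≡ true → odd (suc q) ≡ false →
              Inv (suc q) (suc q) cl (op ∷ʳ suc q)
  open-last {q} {cl} {op} I lᵗ oddᶠ = open-new I lᵗ ∈-++⁺ˡ split (∈-++⁺ʳ op (here refl)) (length-∷ʳ op (suc q))
    (AllPairs.++⁺ (open-ordered I) ([] ∷ []) (All.tabulate λ k∈ → newest k∈ ∷ []))
    where
    split : ∀ {k} → k ∈ op ∷ʳ suc q → k ≡ suc q ⊎ k ∈ op
    split k∈ with ∈-++⁻ op k∈
    ... | inj₁ k∈op = inj₂ k∈op
    ... | inj₂ (here e) = inj₁ e
    newest : ∀ {k} → k ∈ op → k ≺ suc q
    newest k∈ = even-asc (s≤s (proj₁ (Inv.open-valid I k∈))) oddᶠ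

  module Run (L0 : L 0 ≡ false) (R0 : R 0 ≡ false)
             (ballot : ∀ q → R (suc q) ≡ true → #≤ R (suc q) ≤ #≤ L q) where

    State : ℕ → Set
    State q = Σ (List (ℕ × ℕ)) λ cl → Σ (List ℕ) λ op → Inv q q cl op

    start : State 0
    start = [] , [] , record
      { closed-valid = λ () ; open-valid = λ () ; closed-compatible = λ () ; open-compatible = λ ()
      ; open-ordered = [] ; lefts-complete = λ { z≤n lᵗ → ⊥-elim (Bool.not-¬ lᵗ L0) }
      ; rights-complete = λ { z≤n rᵗ → ⊥-elim (Bool.not-¬ rᵗ R0) }
      ; open-count = trans (cong bit R0) (sym (cong bit L0)) }

    nothing-to-close : ∀ {q cl} → Inv q q cl [] → R (suc q) ≡ true → ⊥
    nothing-to-close {q} I rᵗ = 1+n≰n (begin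
      suc (#≤ L q)     ≡⟨ cong suc (open-count I) ⟨
      suc (#≤ R q)     ≡⟨ #≤-suc-true R rᵗ ⟨
      #≤ R (suc q)     ≤⟨ ballot q rᵗ ⟩
      #≤ L q           ∎)
      where open ≤-Reasoning

    close-at : ∀ q → State q → Σ (List (ℕ × ℕ)) λ cl → Σ (List ℕ) λ op → Inv q (suc q) cl op
    close-at q (cl , op , I) with R (suc q) in rᵉ | odd (suc q) in oddᵉ
    ... | false | _ = cl , op , skip-right rᵉ I
    ... | true | true with op
    ...   | [] = ⊥-elim (nothing-to-close I rᵉ)
    ...   | k ∷ rest = _ , rest , close-first I rᵉ oddᵉ
    close-at q (cl , op , I) | true | false with reverseView op
    ...   | [] = ⊥-elim (nothing-to-close I rᵉ)
    ...   | rest ∶ _ ∶ʳ k = _ , rest , close-last I rᵉ oddᵉ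

    step : ∀ q → State q → State (suc q)
    step q s with close-at q s
    ... | cl , op , I with L (suc q) in lᵉ | odd (suc q) in oddᵉ
    ...   | false | _ = cl , op , skip-left lᵉ I
    ...   | true | true = cl , _ , open-first I lᵉ oddᵉ
    ...   | true | false = cl , _ , open-last I lᵉ oddᵉ

    run : ∀ q → State q
    run zero = start
    run (suc q) = step q (run q)

    all-closed : ∀ {q cl op} → Inv q q cl op → #≤ R q ≡ #≤ L q → op ≡ []
    all-closed {op = []} _ _ = refl
    all-closed {q} {op = k ∷ op} I total = ⊥-elim (1+n≰n (≤-trans (s≤s (m≤n+m (#≤ R q) (length op)))
                                                       (≤-reflexive (trans (open-count I) (sym total)))))

-- Surjectivity

module Surjection {n w} (mbar : Mbar (suc n) w) where

  f : ℕ → Step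
  f = letter w

  w≡ : w ≡ applyUpTo f (suc n)
  w≡ = trans (applyUpTo-letter w) (cong (applyUpTo f) (proj₁ (proj₁ mbar)))

  motzkin : Motzkin (suc n) (applyUpTo f (suc n))
  motzkin = subst (Motzkin (suc n)) w≡ (proj₁ mbar)

  balanced : ∀ i → i ≤ suc n → downs f i ≤ ups f i
  balanced = motzkin-prefix f motzkin

  first : isD (f 0) ≡ false
  first with f 0 | balanced 1 (s≤s z≤n)
  ... | U | _ = refl
  ... | H | _ = refl
  ... | D | ()

  last : isU (f n) ≡ false
  last with f n in fᵉ
  ... | D = refl
  ... | H = refl
  ... | U = ⊥-elim (1+n≰n (begin
    suc (ups f n)                ≡⟨ +-comm 1 _ ⟩
    ups f n + bit (isU U)        ≡⟨ cong (λ s → ups f n + bit (isU s)) fᵉ ⟨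
    ups f n + bit (isU (f n))    ≡⟨ ups-suc f n ⟨
    ups f (suc n)                ≡⟨ proj₁ (proj₂ motzkin) ⟩
    downs f (suc n)              ≡⟨ downs-suc f n ⟩
    downs f n + bit (isD (f n))  ≡⟨ cong (λ s → downs f n + bit (isD s)) fᵉ ⟩
    downs f n + 0                ≡⟨ +-identityʳ _ ⟩
    downs f n                    ≤⟨ balanced n (n≤1+n n) ⟩
    ups f n                      ∎))
    where open ≤-Reasoning

  -- the left and right endpoints that Ψ⁻¹(w) must have
  Lw : ℕ → Bool
  Lw zero = false
  Lw (suc m) = (m <ᵇ n) ∧ not (isD (f (suc m)))

  Rw : ℕ → Bool
  Rw zero = false
  Rw (suc zero) = false
  Rw (suc (suc m)) = (m <ᵇ n) ∧ not (isU (f m))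

  Lw-bound : ∀ {p} → Lw p ≡ true → 1 ≤ p × p ≤ n
  Lw-bound {suc m} lᵗ = s≤s z≤n , reflects-true⇒ (<ᵇ-reflects-< m n) (proj₁ (∧-true lᵗ))

  Rw-bound : ∀ {p} → Rw p ≡ true → p ≤ suc n
  Rw-bound {suc (suc m)} rᵗ = s≤s (reflects-true⇒ (<ᵇ-reflects-< m n) (proj₁ (∧-true rᵗ)))

  Lw-suc : ∀ {m} → m < n → Lw (suc m) ≡ not (isD (f (suc m)))
  Lw-suc {m} m<n = cong (_∧ not (isD (f (suc m)))) (reflects⇒true (<ᵇ-reflects-< m n) m<n)

  Rw-suc-suc : ∀ {m} → m < n → Rw (suc (suc m)) ≡ not (isU (f m))
  Rw-suc-suc {m} m<n = cong (_∧ not (isU (f m))) (reflects⇒true (<ᵇ-reflects-< m n) m<n)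

  #Lw-+-downs : ∀ q → q ≤ n → #≤ Lw q + downs f (suc q) ≡ q
  #Lw-+-downs zero _ = trans (downs-suc f 0) (cong bit first)
  #Lw-+-downs (suc q) sq≤n = begin
    #≤ Lw (suc q) + downs f (suc (suc q))
      ≡⟨ cong (#≤ Lw (suc q) +_) (downs-suc f (suc q)) ⟩
    (#≤ Lw q + bit (Lw (suc q))) + (downs f (suc q) + bit (isD (f (suc q))))
      ≡⟨ interchange (#≤ Lw q) _ _ _ ⟩
    (#≤ Lw q + downs f (suc q)) + (bit (Lw (suc q)) + bit (isD (f (suc q))))
      ≡⟨ cong₂ _+_ (#Lw-+-downs q (<⇒≤ sq≤n)) (bit-complement (Lw-suc sq≤n)) ⟩
    q + 1
      ≡⟨ +-comm q 1 ⟩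
    suc q ∎
    where open ≡-Reasoning

  #Rw-+-ups : ∀ q → q ≤ n → #≤ Rw (suc q) + ups f q ≡ q
  #Rw-+-ups zero _ = refl
  #Rw-+-ups (suc q) sq≤n = begin
    #≤ Rw (suc (suc q)) + ups f (suc q)
      ≡⟨ cong (#≤ Rw (suc (suc q)) +_) (ups-suc f q) ⟩
    (#≤ Rw (suc q) + bit (Rw (suc (suc q)))) + (ups f q + bit (isU (f q)))
      ≡⟨ interchange (#≤ Rw (suc q)) _ _ _ ⟩
    (#≤ Rw (suc q) + ups f q) + (bit (Rw (suc (suc q))) + bit (isU (f q)))
      ≡⟨ cong₂ _+_ (#Rw-+-ups q (<⇒≤ sq≤n)) (bit-complement (Rw-suc-suc sq≤n)) ⟩
    q + 1
      ≡⟨ +-comm q 1 ⟩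
    suc q ∎
    where open ≡-Reasoning

  ballot : ∀ q → Rw (suc q) ≡ true → #≤ Rw (suc q) ≤ #≤ Lw q
  ballot zero ()
  ballot (suc m) rᵗ = +-cancelʳ-≤ (downs f (suc (suc m))) _ _ (begin
    #≤ Rw (suc (suc m)) + downs f (suc (suc m))   ≤⟨ +-monoʳ-≤ (#≤ Rw (suc (suc m))) downs≤ups ⟩
    #≤ Rw (suc (suc m)) + ups f (suc m)           ≡⟨ #Rw-+-ups (suc m) m<n ⟩
    suc m                                         ≡⟨ #Lw-+-downs (suc m) m<n ⟨
    #≤ Lw (suc m) + downs f (suc (suc m))         ∎)
    where
    open ≤-Reasoning
    m<n : m < n
    m<n = reflects-true⇒ (<ᵇ-reflects-< m n) (proj₁ (∧-true rᵗ))
    downs≤ups : downs f (suc (suc m)) ≤ ups f (suc m)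
    downs≤ups with f (suc m) in fᵉ
    ... | U = begin
      downs f (suc (suc m))               ≡⟨ downs-suc f (suc m) ⟩
      downs f (suc m) + bit (isD (f (suc m)))  ≡⟨ cong (λ s → downs f (suc m) + bit (isD s)) fᵉ ⟩
      downs f (suc m) + 0                 ≡⟨ +-identityʳ _ ⟩
      downs f (suc m)                     ≤⟨ balanced (suc m) (s≤s (<⇒≤ m<n)) ⟩
      ups f (suc m)                       ∎
    ... | D = ≤-trans (balanced (suc (suc m)) (s≤s m<n)) (≤-reflexive (trans (ups-suc f (suc m))
                (trans (cong (λ s → ups f (suc m) + bit (isU s)) fᵉ) (+-identityʳ _))))
    ... | H = ≤-trans (balanced (suc (suc m)) (s≤s m<n)) (≤-reflexive (trans (ups-suc f (suc m))
                (trans (cong (λ s → ups f (suc m) + bit (isU s)) fᵉ) (+-identityʳ _))))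

  balanced-total : #≤ Rw (suc n) ≡ #≤ Lw (suc n)
  balanced-total = +-cancelʳ-≡ (ups f n) _ _ (begin
    #≤ Rw (suc n) + ups f n          ≡⟨ #Rw-+-ups n ≤-refl ⟩
    n                                ≡⟨ #Lw-+-downs n ≤-refl ⟨
    #≤ Lw n + downs f (suc n)        ≡⟨ cong₂ _+_ Lw-last (sym ups≡downs) ⟩
    #≤ Lw (suc n) + ups f n          ∎)
    where
    open ≡-Reasoning
    Lw-last : #≤ Lw n ≡ #≤ Lw (suc n)
    Lw-last = sym (#≤-suc-false Lw (cong (_∧ not (isD (f (suc n))))
                                         (reflects⇒false (<ᵇ-reflects-< n n) (<-irrefl refl))))
    ups≡downs : ups f n ≡ downs f (suc n)
    ups≡downs = trans (sym (trans (ups-suc f n) (trans (cong (λ b → ups f n + bit b) last) (+-identityʳ _))))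
                      (proj₁ (proj₂ motzkin))

  open Matching Lw Rw
  open Run refl refl ballot
  open Inv

  pairs : List (ℕ × ℕ)
  pairs = proj₁ (run (suc n))

  inv : Inv (suc n) (suc n) pairs (proj₁ (proj₂ (run (suc n))))
  inv = proj₂ (proj₂ (run (suc n)))

  nothing-open : proj₁ (proj₂ (run (suc n))) ≡ []
  nothing-open = all-closed inv balanced-total

  δ : Diagram
  δ = map (uncurry sortableArc) pairs

  ∈δ⁻ : ∀ {a} → a ∈ δ → Σ (ℕ × ℕ) λ (x , y) → (x , y) ∈ pairs × a ≡ sortableArc x y
  ∈δ⁻ a∈δ = ∈-map⁻ (uncurry sortableArc) a∈δ

  ∈δ⁺ : ∀ {x y} → (x , y) ∈ pairs → sortableArc x y ∈ δ
  ∈δ⁺ = ∈-map⁺ (uncurry sortableArc)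

  right-pair : ∀ {x y} → (x , y) ∈ pairs → right (sortableArc x y) ≡ y
  right-pair c∈ = right-sortableArc (proj₁ (closed-valid inv c∈))

  left-matched : ∀ {p} → Lw p ≡ true → Σ ℕ λ y → (p , y) ∈ pairs
  left-matched lᵗ with lefts-complete inv (m≤n⇒m≤1+n (proj₂ (Lw-bound lᵗ))) lᵗ
  ... | inj₁ matched = matched
  ... | inj₂ p∈open = ⊥-elim (case subst (_ ∈_) nothing-open p∈open of λ ())

  isLeftEnd≡Lw : ∀ p → isLeftEnd δ p ≡ Lw p
  isLeftEnd≡Lw p = det (anyEnd-reflects left δ p) (fromEquivalence to from)
    where
    to : T (Lw p) → LeftEnd δ p
    to t = let (y , c∈) = left-matched (Equivalence.to Bool.T-≡ t) in _ , ∈δ⁺ c∈ , refl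
    from : LeftEnd δ p → T (Lw p)
    from (a , a∈δ , refl) with ∈δ⁻ a∈δ
    ... | _ , c∈ , refl = Equivalence.from Bool.T-≡ (proj₁ (proj₂ (proj₂ (closed-valid inv c∈))))

  isRightEnd≡Rw : ∀ p → isRightEnd δ p ≡ Rw p
  isRightEnd≡Rw p = det (anyEnd-reflects right δ p) (fromEquivalence to from)
    where
    to : T (Rw p) → RightEnd δ p
    to t = let rᵗ = Equivalence.to Bool.T-≡ t ; (x , c∈) = rights-complete inv (Rw-bound rᵗ) rᵗ
           in _ , ∈δ⁺ c∈ , right-pair c∈
    from : RightEnd δ p → T (Rw p)
    from (a , a∈δ , refl) with ∈δ⁻ a∈δ
    ... | _ , c∈ , refl = Equivalence.from Bool.T-≡
            (subst (λ y → Rw y ≡ true) (sym (right-pair c∈)) (proj₂ (proj₂ (proj₂ (closed-valid inv c∈)))))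

  sortableDiagram : SortableDiagram n δ
  sortableDiagram = (inRange , separated) , sortable
    where
    inRange : ∀ a → a ∈ δ → InRange n a
    inRange a a∈δ with ∈δ⁻ a∈δ
    ... | _ , c∈ , refl = let (_ , y≤sn , lx , _) = closed-valid inv c∈
                          in proj₁ (Lw-bound lx) , subst (_≤ suc n) (sym (right-pair c∈)) y≤sn
    sortable : ∀ a → a ∈ δ → Sortable a
    sortable a a∈δ with ∈δ⁻ a∈δ
    ... | (x , y) , _ , refl = sortableArc-sortable x y
    separated : ∀ a b → a ∈ δ → b ∈ δ → a ≢ b → Separated a b
    separated a b a∈δ b∈δ a≢b with ∈δ⁻ a∈δ | ∈δ⁻ b∈δ
    ... | (x , y) , c∈ , refl | (k , z) , d∈ , refl =
      compatible⇒separated (sortableArc-sortable x y) (sortableArc-sortable k z)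
        (subst₂ Compatible (cong (x ,_) (sym (right-pair c∈))) (cong (k ,_) (sym (right-pair d∈)))
          (closed-compatible inv c∈ d∈ λ c≡d → a≢b (cong (uncurry sortableArc) c≡d)))

  excl : UDExclusive n δ
  excl (suc m) _ sm≤n lᶠ = trans (isRightEnd≡Rw (suc (suc (suc m)))) (trans (Rw-suc-suc sm≤n) (cong not isU≡false))
    where
    isU≡false : isU (f (suc m)) ≡ false
    isU≡false with f (suc m) in fᵉ | trans (sym (Lw-suc (<⇒≤ sm≤n))) (trans (sym (isLeftEnd≡Lw (suc m))) lᶠ)
    ... | D | _ = refl
    ... | U | ()
    ... | H | ()

  Ψ≡w : Ψ n δ ≡ w
  Ψ≡w = begin
    Ψ n δ                                         ≡⟨ Ψ≡applyUpTo n δ ⟩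
    applyUpTo (λ k → Ψstep n δ (suc k)) (suc n)   ≡⟨ applyUpTo-cong (suc n) (λ _ k<sn → isU-isD-injective (sameU k<sn) (sameD k<sn)) ⟩
    applyUpTo f (suc n)                           ≡⟨ w≡ ⟨
    w                                             ∎
    where
    open ≡-Reasoning
    sameU : ∀ {k} → k < suc n → isU (Ψstep n δ (suc k)) ≡ isU (f k)
    sameU {k} k<sn with m≤n⇒m<n∨m≡n (≤-pred k<sn)
    ... | inj₂ refl = trans (isU-Ψstep-last n δ) (sym last)
    ... | inj₁ k<n = trans (isU-Ψstep-≤ n δ k<n) (trans (cong not (trans (isRightEnd≡Rw (suc (suc k))) (Rw-suc-suc k<n)))
                                                     (Bool.not-involutive _))
    sameD : ∀ {k} → k < suc n → isD (Ψstep n δ (suc k)) ≡ isD (f k)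
    sameD {zero} _ = trans (isD-Ψstep-first n δ) (sym first)
    sameD {suc m} (s≤s m<n) = trans (isD-Ψstep-≤ n δ excl m<n)
                               (trans (cong not (trans (isLeftEnd≡Lw (suc m)) (Lw-suc m<n))) (Bool.not-involutive _))

  mad : MAD n δ
  mad = UDExclusive-noPeak⇒MAD sortableDiagram excl (subst (¬_ ∘ PeakOfHeight1) (sym Ψ≡w) (proj₂ mbar))

Ψ-surjective : ∀ {n w} → Mbar (suc n) w → Σ Diagram λ δ → MAD n δ × Ψ n δ ≡ w
Ψ-surjective mbar = δ , mad , Ψ≡w
  where open Surjection mbar

theorem8p10 : (n : ℕ) → 1 ≤ n →
    ((δ : Diagram) → MAD n δ → Mbar (suc n) (Ψ n δ)) ×
    ((δ δ' : Diagram) → MAD n δ → MAD n δ' → Ψ n δ ≡ Ψ n δ' → SameSet δ δ') ×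
    ((w : List Step) → Mbar (suc n) w → Σ Diagram λ δ → MAD n δ × Ψ n δ ≡ w)
theorem8p10 n _ = (λ _ → Ψ-Mbar) , (λ _ _ mad mad′ → Ψ-injective mad mad′) , (λ _ → Ψ-surjective)
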